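{- Let $G$ be a connected graph and let $t\geq 3$ be an integer, and assume $G$ is not a star $K_{1,s}$ for any $1\leq s\leq t-1$. For an integer $k\geq 2$, define the following conditions on $G$: \begin{itemize} \item $C_1^k$: $2\leq \operatorname{diam}(G)\leq 2k$. \item $C_2^k$: for every integer $s\geq k+1$, $G$ contains no induced subgraph isomorphic to $K_{1,s}$. \item $C_3^k$: for every induced matching $M$ of $G$ with $|M|=k$ (if one exists), every vertex $z\in V(G)\setminus V(G[M])$ is adjacent to at least two vertices of $V(G[M])$. \item $C_4^k$ (defined only when $k\geq 3$): for every $s$ with $2\leq s\leq k-1$, every partition $\{r_1,\dots,r_s\}$ of $k$ into $s$ parts with $1\leq r_1\leq\cdots\leq r_s$, and every edge open packing set $D^s$ of $G$ with $|D^s|=k$ such that the components of $G[D^s]$ are $D_1,\dots,D_s$ with $D_i\cong K_{1,r_i}$, every vertex $z\in V(G)\setminus V(G[D^s])$ adjacent to the centre vertex $u_j$ of some $D_j$ (for a single-edge $D_j$, one of its end vertices is regarded as the centre) is adjacent to at least one vertex of $V(G[D^s])\setminus\{u_j\}$. \end{itemize} Let $\mathcal{F}_k$ be the set of these conditions ($\mathcal{F}_2=\{C_1^2,C_2^2,C_3^2\}$, and $\mathcal{F}_k=\{C_1^k,C_2^k,C_3^k,C_4^k\}$ for $k\geq 3$). Then $\rho_{e}^o(G)=t$ if and only if $G$ satisfies all conditions of $\mathcal{F}_t$ and does not satisfy at least one condition of $\mathcal{F}_{t-1}$.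
   Context: All graphs are finite and simple. For edges $e_1,e_2\in E(G)$, an edge $e\neq e_1,e_2$ is a common edge of $e_1,e_2$ if $e$ joins an endpoint of $e_1$ to an endpoint of $e_2$. A set $D\subseteq E(G)$ is an edge open packing (EOP) set if no two distinct edges of $D$ have a common edge in $G$; $\rho_e^o(G)$ is the maximum size of an EOP set. For $B\subseteq E(G)$, $G[B]$ is the subgraph of $G$ induced by the endpoints of edges in $B$. An induced matching is a matching no two of whose edges are joined by an edge of $G$. -}

module Defs where

open import Data.Nat using (ℕ; zero; suc; _+_; _*_; _∸_; _≤_; _<_)
open import Data.Fin using (Fin) renaming (_<_ to _<ᶠ_; _≤_ to _≤ᶠ_)
open import Data.Bool using (Bool; true; false)
open import Data.List using (List; length; map; allFin)
open import Data.Nat.ListAction using (sum)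
open import Data.List.Membership.Propositional using (_∈_)
open import Data.List.Relation.Unary.All using (All)
open import Data.List.Relation.Unary.AllPairs using (AllPairs)
open import Data.List.Relation.Unary.Unique.Propositional using (Unique)
open import Data.Product using (Σ; _×_; _,_)
open import Data.Sum using (_⊎_)
open import Relation.Nullary using (¬_)
open import Relation.Binary.PropositionalEquality using (_≡_; _≢_)

record Graph (n : ℕ) : Set where
  field
    adj    : Fin n → Fin n → Bool
    sym    : ∀ u v → adj u v ≡ adj v u
    irrefl : ∀ u → adj u u ≡ false

module _ {n : ℕ} (G : Graph n) where

  Adj : Fin n → Fin n → Set
  Adj u v = Graph.adj G u v ≡ true

  data Walk : Fin n → Fin n → ℕ → Set where
    here : ∀ {u} → Walk u u 0
    step : ∀ {u w v L} → Adj u w → Walk w v L → Walk u v (suc L)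

  Connected : Set
  Connected = ∀ u v → Σ ℕ λ L → Walk u v L

  DistLe : Fin n → Fin n → ℕ → Set
  DistLe u v d = Σ ℕ λ L → L ≤ d × Walk u v L

  DiamAtMost : ℕ → Set
  DiamAtMost d = ∀ u v → DistLe u v d

  DiamAtLeast2 : Set
  DiamAtLeast2 = Σ (Fin n) λ u → Σ (Fin n) λ v → ¬ DistLe u v 1

  IsStar : ℕ → Set
  IsStar s = (n ≡ suc s) × Σ (Fin n) λ c →
    (∀ v → v ≢ c → Adj c v) × (∀ u v → Adj u v → (u ≡ c) ⊎ (v ≡ c))

  InducedStar : ℕ → Set
  InducedStar s = Σ (Fin n) λ c → Σ (List (Fin n)) λ L →
    Unique L × length L ≡ s × All (Adj c) L × AllPairs (λ x y → ¬ Adj x y) L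

  record Edge : Set where
    constructor edge
    field
      lo hi : Fin n
      lo<hi : lo <ᶠ hi
      isAdj : Adj lo hi
  open Edge public

  Endpoint : Edge → Fin n → Set
  Endpoint e x = (x ≡ lo e) ⊎ (x ≡ hi e)

  SameEnds : Edge → Fin n → Fin n → Set
  SameEnds e x y = (x ≡ lo e × y ≡ hi e) ⊎ (x ≡ hi e × y ≡ lo e)

  DistinctE : Edge → Edge → Set
  DistinctE e f = ¬ (lo e ≡ lo f × hi e ≡ hi f)

  HasCommonEdge : Edge → Edge → Set
  HasCommonEdge e₁ e₂ = Σ (Fin n) λ x → Σ (Fin n) λ y →
    Endpoint e₁ x × Endpoint e₂ y × Adj x y × ¬ SameEnds e₁ x y × ¬ SameEnds e₂ x y

  IsEOP : List Edge → Set
  IsEOP D = AllPairs (λ e f → DistinctE e f × ¬ HasCommonEdge e f) D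

  EOPNumberIs : ℕ → Set
  EOPNumberIs t = (Σ (List Edge) λ D → IsEOP D × length D ≡ t)
                × (∀ D → IsEOP D → length D ≤ t)

  VG : List Edge → Fin n → Set
  VG B x = Σ Edge λ e → e ∈ B × Endpoint e x

  IsInducedMatching : List Edge → Set
  IsInducedMatching M = AllPairs
    (λ e f → ∀ x y → Endpoint e x → Endpoint f y → (x ≢ y) × ¬ Adj x y) M

  C₁ : ℕ → Set
  C₁ k = DiamAtLeast2 × DiamAtMost (2 * k)

  C₂ : ℕ → Set
  C₂ k = ∀ s → k + 1 ≤ s → ¬ InducedStar s

  C₃ : ℕ → Set
  C₃ k = ∀ M → IsInducedMatching M → length M ≡ k →
    ∀ z → ¬ VG M z →
    Σ (Fin n) λ x → Σ (Fin n) λ y → x ≢ y × VG M x × VG M y × Adj z x × Adj z y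

  IsPartition : ℕ → (s : ℕ) → (Fin s → ℕ) → Set
  IsPartition k s r = (∀ i → 1 ≤ r i) × (∀ i j → i ≤ᶠ j → r i ≤ r j)
                    × sum (map r (allFin s)) ≡ k

  InComp : ∀ {s} → (Fin s → Fin n) → (Fin s → List (Fin n)) → Fin s → Fin n → Set
  InComp centre leaves i x = (x ≡ centre i) ⊎ (x ∈ leaves i)

  record StarComponents (D : List Edge) (s : ℕ) (r : Fin s → ℕ) : Set where
    field
      centre       : Fin s → Fin n
      leaves       : Fin s → List (Fin n)
      leavesUnique : ∀ i → Unique (leaves i)
      leavesCount  : ∀ i → length (leaves i) ≡ r i
      centreAdj    : ∀ i → All (Adj (centre i)) (leaves i)
      leavesIndep  : ∀ i → AllPairs (λ x y → ¬ Adj x y) (leaves i)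
      cover        : ∀ x → VG D x → Σ (Fin s) λ i → InComp centre leaves i x
      within       : ∀ i x → InComp centre leaves i x → VG D x
      disjoint     : ∀ i j x → i ≢ j → InComp centre leaves i x → ¬ InComp centre leaves j x
      separated    : ∀ i j x y → i ≢ j → InComp centre leaves i x →
                     InComp centre leaves j y → ¬ Adj x y

  C₄ : ℕ → Set
  C₄ k = ∀ s → 2 ≤ s → s ≤ k ∸ 1 → ∀ r → IsPartition k s r →
    ∀ D → IsEOP D → length D ≡ k → (SC : StarComponents D s r) →
    ∀ j z → ¬ VG D z → Adj z (StarComponents.centre SC j) →
    Σ (Fin n) λ y → VG D y × y ≢ StarComponents.centre SC j × Adj z y

  AllF : ℕ → Set
  AllF k = C₁ k × C₂ k × C₃ k × (3 ≤ k → C₄ k)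

module Submission where

-- An edge set D is an EOP set exactly when the subgraph G[D] spanned by its ends is a star forest,
-- so large EOP sets come from star forests.  If every EOP set has at most k edges, each condition
-- of 𝓕_k holds, because a violation yields a star forest with k + 1 edges: every other pair of
-- edges on a shortest path of length 2k + 1 (C₁), an induced K_{1,k+1} (C₂), and for C₃ and C₄
-- the given set plus the edge from z to its only neighbour (or, if z sees nothing of an induced
-- matching, the matching rerouted through a neighbour of z).  Conversely, C₂, C₃ and C₄ for k
-- exclude an EOP set D of size k + 1: if G[D] is an induced matching, C₃ fails for D minus an
-- edge; if G[D] is a single star, C₂ fails; otherwise dropping a leaf edge uy of a star with two
-- leaves leaves y adjacent only to the centre u, against C₃ or C₄ for the remaining k edges.
-- Both directions, for k = t and k = t − 1, give the theorem.

open import Axiom.UniquenessOfIdentityProofs using (module Decidable⇒UIP)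
open import Data.Bool using (true)
import Data.Bool.Properties as Bool
open import Data.Empty using (⊥; ⊥-elim)
open import Data.Fin using (Fin; zero; suc; toℕ; fromℕ<) renaming (_<_ to _<ᶠ_)
import Data.Fin.Properties as Finₚ
open import Data.List using (List; []; _∷_; _++_; length; map; allFin; concatMap; lookup; tabulate; filter; take)
import Data.List.Properties as Listₚ
open import Data.List.Membership.Propositional using (_∈_; find; lose)
open import Data.List.Membership.Propositional.Properties
  using (∈-∃++; ∈-map⁺; ∈-map⁻; ∈-lookup; ∈-allFin; ∈-filter⁺; ∈-filter⁻; ∈-concatMap⁺; ∈-concatMap⁻)
open import Data.List.Relation.Binary.Permutation.Propositional using (_↭_; ↭-sym; ↭⇒↭ₛ)
open import Data.List.Relation.Binary.Permutation.Propositional.Properties using (shift; ∈-resp-↭; ↭-length)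
import Data.List.Relation.Binary.Permutation.Setoid.Properties as Permutationₛ
open import Data.List.Relation.Unary.All as All using (All; []; _∷_)
import Data.List.Relation.Unary.All.Properties as Allₚ
open import Data.List.Relation.Unary.AllPairs as AllPairs using (AllPairs; []; _∷_)
import Data.List.Relation.Unary.AllPairs.Properties as AllPairsₚ
open import Data.List.Relation.Unary.Any as Any using (here; there)
import Data.List.Relation.Unary.Any.Properties as Anyₚ
import Data.List.Relation.Unary.Sorted.TotalOrder.Properties as Sortedₚ
open import Data.List.Relation.Unary.Unique.Propositional using (Unique)
import Data.List.Relation.Unary.Unique.Propositional.Properties as Uniqueₚ
import Data.List.Sort as Sort
open import Data.Nat using (ℕ; zero; suc; _+_; _*_; _∸_; _≤_; z≤n; s≤s)
import Data.Nat.Properties as ℕₚ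
open import Data.Nat.ListAction using (sum)
open import Data.Product using (Σ; ∃; _×_; _,_; proj₁; proj₂)
open import Data.Sum using (_⊎_; inj₁; inj₂; [_,_]′)
open import Function using (_∘_; id)
open import Function.Bundles using (_⇔_; mk⇔)
open import Relation.Binary using (DecTotalOrder; tri<; tri≈; tri>)
import Relation.Binary.Construct.On as On
open import Relation.Binary.PropositionalEquality
  using (_≡_; _≢_; refl; sym; trans; cong; cong₂; subst; subst₂; setoid; module ≡-Reasoning)
open import Relation.Nullary using (¬_; Dec; yes; no)
open import Relation.Nullary.Decidable using (map′; _×-dec_; _⊎-dec_; _→-dec_; ¬?)

open import Defs

module _ {A : Set} where

  AllPairs-∈ : ∀ {R : A → A → Set} {xs x y} → AllPairs R xs → x ∈ xs → y ∈ xs →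
               x ≡ y ⊎ R x y ⊎ R y x
  AllPairs-∈ (_ ∷ _)  (here refl) (here refl) = inj₁ refl
  AllPairs-∈ (r ∷ _)  (here refl) (there y∈) = inj₂ (inj₁ (All.lookup r y∈))
  AllPairs-∈ (r ∷ _)  (there x∈)  (here refl) = inj₂ (inj₂ (All.lookup r x∈))
  AllPairs-∈ (_ ∷ rs) (there x∈)  (there y∈) = AllPairs-∈ rs x∈ y∈

  AllPairs-tabulate∈ : ∀ {R : A → A → Set} xs → (∀ {x y} → x ∈ xs → y ∈ xs → R x y) → AllPairs R xs
  AllPairs-tabulate∈ []       r = []
  AllPairs-tabulate∈ (x ∷ xs) r =
    All.tabulate (λ y∈ → r (here refl) (there y∈)) ∷ AllPairs-tabulate∈ xs λ x∈ y∈ → r (there x∈) (there y∈)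

  AllPairs-mapWith∈ : ∀ {R S : A → A → Set} xs → (∀ {x y} → x ∈ xs → y ∈ xs → R x y → S x y) →
                      AllPairs R xs → AllPairs S xs
  AllPairs-mapWith∈ []       f []       = []
  AllPairs-mapWith∈ (x ∷ xs) f (r ∷ rs) =
    All.tabulate (λ y∈ → f (here refl) (there y∈) (All.lookup r y∈))
    ∷ AllPairs-mapWith∈ xs (λ x∈ y∈ → f (there x∈) (there y∈)) rs

  ∈⇒↭∷ : ∀ {x : A} {xs} → x ∈ xs → ∃ λ ys → xs ↭ x ∷ ys
  ∈⇒↭∷ x∈xs with ys , zs , refl ← ∈-∃++ x∈xs = ys ++ zs , shift _ ys zs

  Unique-⊆⇒length≤ : ∀ {xs ys : List A} → Unique xs → (∀ {x} → x ∈ xs → x ∈ ys) → length xs ≤ length ys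
  Unique-⊆⇒length≤ {[]}     _          _   = z≤n
  Unique-⊆⇒length≤ {x ∷ xs} (x∉ ∷ uxs) sub with zs , ys↭ ← ∈⇒↭∷ (sub (here refl)) =
    subst (suc (length xs) ≤_) (sym (↭-length ys↭)) (s≤s (Unique-⊆⇒length≤ uxs sub′))
    where
    sub′ : ∀ {a} → a ∈ xs → a ∈ zs
    sub′ a∈ with ∈-resp-↭ ys↭ (sub (there a∈))
    ... | here refl = ⊥-elim (All.lookup x∉ a∈ refl)
    ... | there a∈zs = a∈zs

  2≤length : ∀ {x y : A} {xs} → x ∈ xs → y ∈ xs → x ≢ y → 2 ≤ length xs
  2≤length {xs = _ ∷ []}    (here refl) (here refl) x≢y = ⊥-elim (x≢y refl)
  2≤length {xs = _ ∷ _ ∷ _} _           _           _   = s≤s (s≤s z≤n)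

  suc-length≤sum : (f : A → ℕ) {xs : List A} → All (λ a → 1 ≤ f a) xs →
                   ∀ {a} → a ∈ xs → 2 ≤ f a → suc (length xs) ≤ sum (map f xs)
  suc-length≤sum f {x ∷ xs} (1≤fx ∷ ps) (here refl) 2≤fa = ℕₚ.+-mono-≤ 2≤fa (length≤sum ps)
    where
    length≤sum : ∀ {ys} → All (λ a → 1 ≤ f a) ys → length ys ≤ sum (map f ys)
    length≤sum []       = z≤n
    length≤sum (q ∷ qs) = ℕₚ.+-mono-≤ q (length≤sum qs)
  suc-length≤sum f {x ∷ xs} (1≤fx ∷ ps) (there a∈) 2≤fa = ℕₚ.+-mono-≤ 1≤fx (suc-length≤sum f ps a∈ 2≤fa)

  1≤length : ∀ {x : A} {xs} → x ∈ xs → 1 ≤ length xs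
  1≤length (here _)  = s≤s z≤n
  1≤length (there _) = s≤s z≤n

  lookup-injective : ∀ {xs : List A} → Unique xs → ∀ {i j} → lookup xs i ≡ lookup xs j → i ≡ j
  lookup-injective {_ ∷ _}  _          {zero}  {zero}  _  = refl
  lookup-injective {_ ∷ xs} (x∉ ∷ _)   {zero}  {suc j} eq = ⊥-elim (All.lookup x∉ (∈-lookup j) eq)
  lookup-injective {_ ∷ xs} (x∉ ∷ _)   {suc i} {zero}  eq = ⊥-elim (All.lookup x∉ (∈-lookup i) (sym eq))
  lookup-injective {_ ∷ xs} (_ ∷ uxs) {suc i} {suc j} eq = cong suc (lookup-injective uxs eq)

  map-lookup-allFin : ∀ {B : Set} (f : A → B) xs → map (λ i → f (lookup xs i)) (allFin (length xs)) ≡ map f xs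
  map-lookup-allFin f xs = begin
    map (λ i → f (lookup xs i)) (tabulate id) ≡⟨ Listₚ.map-tabulate id (λ i → f (lookup xs i)) ⟩
    tabulate (λ i → f (lookup xs i))          ≡⟨ Listₚ.map-tabulate (lookup xs) f ⟨
    map f (tabulate (lookup xs))              ≡⟨ cong (map f) (Listₚ.tabulate-lookup xs) ⟩
    map f xs                                  ∎
    where open ≡-Reasoning

  sum-map-length : ∀ {B : Set} (f : A → List B) xs → sum (map (λ a → length (f a)) xs) ≡ length (concatMap f xs)
  sum-map-length f []       = refl
  sum-map-length f (x ∷ xs) = trans (cong (length (f x) +_) (sum-map-length f xs)) (sym (Listₚ.length-++ (f x)))

2≤-distinct : ∀ {s} {i j : Fin s} → i ≢ j → 2 ≤ s
2≤-distinct {suc zero}    {zero} {zero} i≢j = ⊥-elim (i≢j refl)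
2≤-distinct {suc (suc _)} _                  = s≤s (s≤s z≤n)

module _ {n : ℕ} {G : Graph n} where

  private
    variable
      c c′ p u v w x y z : Fin n
      e f : Edge G
      D M : List (Edge G)
      S T : Fin n → Set
      d k m : ℕ

  adj? : ∀ x y → Dec (Adj G x y)
  adj? x y = Graph.adj G x y Bool.≟ true

  Adj-sym : Adj G x y → Adj G y x
  Adj-sym {x} {y} xy = trans (Graph.sym G y x) xy

  Adj-irrefl : ¬ Adj G x x
  Adj-irrefl {x} xx with () ← trans (sym xx) (Graph.irrefl G x)

  Adj⇒≢ : Adj G x y → x ≢ y
  Adj⇒≢ xy refl = Adj-irrefl xy

  Endpoint? : ∀ e x → Dec (Endpoint G e x)
  Endpoint? e x = (x Finₚ.≟ lo e) ⊎-dec (x Finₚ.≟ hi e)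

  SameEnds? : ∀ e x y → Dec (SameEnds G e x y)
  SameEnds? e x y = ((x Finₚ.≟ lo e) ×-dec (y Finₚ.≟ hi e)) ⊎-dec ((x Finₚ.≟ hi e) ×-dec (y Finₚ.≟ lo e))

  SameEnds-sym : ∀ e → SameEnds G e x y → SameEnds G e y x
  SameEnds-sym e (inj₁ (x≡ , y≡)) = inj₂ (y≡ , x≡)
  SameEnds-sym e (inj₂ (x≡ , y≡)) = inj₁ (y≡ , x≡)

  SameEnds⇒Endpoints : ∀ e → SameEnds G e x y → Endpoint G e x × Endpoint G e y
  SameEnds⇒Endpoints e (inj₁ (x≡ , y≡)) = inj₁ x≡ , inj₂ y≡
  SameEnds⇒Endpoints e (inj₂ (x≡ , y≡)) = inj₂ x≡ , inj₁ y≡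

  SameEnds⇒Adj : ∀ e → SameEnds G e x y → Adj G x y
  SameEnds⇒Adj e (inj₁ (refl , refl)) = isAdj e
  SameEnds⇒Adj e (inj₂ (refl , refl)) = Adj-sym (isAdj e)

  SameEnds-unique : ∀ e {a b c d} → SameEnds G e a b → SameEnds G e c d →
                    (a ≡ c × b ≡ d) ⊎ (a ≡ d × b ≡ c)
  SameEnds-unique e (inj₁ (refl , refl)) (inj₁ (refl , refl)) = inj₁ (refl , refl)
  SameEnds-unique e (inj₁ (refl , refl)) (inj₂ (refl , refl)) = inj₂ (refl , refl)
  SameEnds-unique e (inj₂ (refl , refl)) (inj₁ (refl , refl)) = inj₂ (refl , refl)
  SameEnds-unique e (inj₂ (refl , refl)) (inj₂ (refl , refl)) = inj₁ (refl , refl)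

  SameEnds-Endpoint : ∀ e → SameEnds G e x y → Endpoint G e w → w ≡ x ⊎ w ≡ y
  SameEnds-Endpoint e (inj₁ (refl , refl)) (inj₁ refl) = inj₁ refl
  SameEnds-Endpoint e (inj₁ (refl , refl)) (inj₂ refl) = inj₂ refl
  SameEnds-Endpoint e (inj₂ (refl , refl)) (inj₁ refl) = inj₂ refl
  SameEnds-Endpoint e (inj₂ (refl , refl)) (inj₂ refl) = inj₁ refl

  partner : ∀ e → Endpoint G e x → ∃ λ y → SameEnds G e x y
  partner e (inj₁ x≡) = hi e , inj₁ (x≡ , refl)
  partner e (inj₂ x≡) = lo e , inj₂ (x≡ , refl)

  Endpoints⇒SameEnds : ∀ e → Endpoint G e x → Endpoint G e y → x ≢ y → SameEnds G e x y
  Endpoints⇒SameEnds e (inj₁ refl) (inj₁ refl) x≢y = ⊥-elim (x≢y refl)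
  Endpoints⇒SameEnds e (inj₁ refl) (inj₂ refl) x≢y = inj₁ (refl , refl)
  Endpoints⇒SameEnds e (inj₂ refl) (inj₁ refl) x≢y = inj₂ (refl , refl)
  Endpoints⇒SameEnds e (inj₂ refl) (inj₂ refl) x≢y = ⊥-elim (x≢y refl)

  SameEnds⇒¬DistinctE : ∀ e f → SameEnds G e x y → SameEnds G f x y → ¬ DistinctE G e f
  SameEnds⇒¬DistinctE e f (inj₁ (refl , refl)) (inj₁ (lo≡ , hi≡)) e≢f = e≢f (lo≡ , hi≡)
  SameEnds⇒¬DistinctE e f (inj₁ (refl , refl)) (inj₂ (hi≡ , lo≡)) e≢f =
    Finₚ.<-asym (lo<hi f) (subst₂ _<ᶠ_ hi≡ lo≡ (lo<hi e))
  SameEnds⇒¬DistinctE e f (inj₂ (refl , refl)) (inj₁ (hi≡ , lo≡)) e≢f =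
    Finₚ.<-asym (lo<hi f) (subst₂ _<ᶠ_ lo≡ hi≡ (lo<hi e))
  SameEnds⇒¬DistinctE e f (inj₂ (refl , refl)) (inj₂ (hi≡ , lo≡)) e≢f = e≢f (lo≡ , hi≡)

  DistinctE-sym : ∀ e f → DistinctE G e f → DistinctE G f e
  DistinctE-sym e f e≢f (lo≡ , hi≡) = e≢f (sym lo≡ , sym hi≡)

  Endpoint⇒DistinctE : ∀ e f → Endpoint G e x → ¬ Endpoint G f x → DistinctE G e f
  Endpoint⇒DistinctE e f (inj₁ refl) x∉f (lo≡ , _) = x∉f (inj₁ lo≡)
  Endpoint⇒DistinctE e f (inj₂ refl) x∉f (_ , hi≡) = x∉f (inj₂ hi≡)

  DistinctE⇒Endpoint∉ : ∀ e f → DistinctE G e f → ∃ λ w → Endpoint G f w × ¬ Endpoint G e w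
  DistinctE⇒Endpoint∉ e f e≢f with Endpoint? e (lo f) | Endpoint? e (hi f)
  ... | no lo∉ | _      = lo f , inj₁ refl , lo∉
  ... | yes _  | no hi∉ = hi f , inj₂ refl , hi∉
  ... | yes lo∈ | yes hi∈ =
    ⊥-elim (SameEnds⇒¬DistinctE e f (Endpoints⇒SameEnds e lo∈ hi∈ (lo≢hi f)) (inj₁ (refl , refl)) e≢f)
    where
    lo≢hi : ∀ f → lo f ≢ hi f
    lo≢hi f lo≡hi = Finₚ.<-irrefl lo≡hi (lo<hi f)

  HasCommonEdge-sym : ∀ e f → HasCommonEdge G e f → HasCommonEdge G f e
  HasCommonEdge-sym e f (x , y , x∈e , y∈f , xy , ≢e , ≢f) =
    y , x , y∈f , x∈e , Adj-sym xy , (λ s → ≢f (SameEnds-sym f s)) , (λ s → ≢e (SameEnds-sym e s))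

  edgeOf : Adj G x y → Edge G
  edgeOf {x} {y} xy with Finₚ.<-cmp x y
  ... | tri< x<y _ _ = edge x y x<y xy
  ... | tri≈ _ refl _ = ⊥-elim (Adj-irrefl xy)
  ... | tri> _ _ y<x = edge y x y<x (Adj-sym xy)

  edgeOf-ends : (xy : Adj G x y) → SameEnds G (edgeOf xy) x y
  edgeOf-ends {x} {y} xy with Finₚ.<-cmp x y
  ... | tri< _ _ _    = inj₁ (refl , refl)
  ... | tri≈ _ refl _ = ⊥-elim (Adj-irrefl xy)
  ... | tri> _ _ _    = inj₂ (refl , refl)

  VG? : ∀ D x → Dec (VG G D x)
  VG? D x = map′ find (λ (e , e∈ , x∈e) → lose e∈ x∈e) (Any.any? (λ e → Endpoint? e x) D)

  VG-mono : ∀ {D D′} → (∀ {e} → e ∈ D → e ∈ D′) → VG G D x → VG G D′ x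
  VG-mono D⊆D′ (e , e∈ , x∈e) = e , D⊆D′ e∈ , x∈e

  VG-neighbour : VG G D x → ∃ λ y → VG G D y × Adj G x y
  VG-neighbour (e , e∈ , x∈e) with y , exy ← partner e x∈e =
    y , (e , e∈ , proj₂ (SameEnds⇒Endpoints e exy)) , SameEnds⇒Adj e exy

  NbrIn : List (Edge G) → Fin n → List (Fin n)
  NbrIn D c = filter (λ v → VG? D v ×-dec adj? c v) (allFin n)

  NbrIn⁺ : VG G D v → Adj G c v → v ∈ NbrIn D c
  NbrIn⁺ {v = v} v∈ cv = ∈-filter⁺ (λ v → VG? _ v ×-dec adj? _ v) (∈-allFin v) (v∈ , cv)

  NbrIn⁻ : v ∈ NbrIn D c → VG G D v × Adj G c v
  NbrIn⁻ {D = D} {c = c} v∈ = proj₂ (∈-filter⁻ (λ v → VG? D v ×-dec adj? c v) {xs = allFin n} v∈)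

  NbrIn-Unique : Unique (NbrIn D c)
  NbrIn-Unique = Uniqueₚ.filter⁺ _ (Uniqueₚ.allFin⁺ n)

  IsEOP-∈ : IsEOP G D → e ∈ D → f ∈ D → e ≡ f ⊎ (DistinctE G e f × ¬ HasCommonEdge G e f)
  IsEOP-∈ {e = e} {f} eop e∈ f∈ with AllPairs-∈ eop e∈ f∈
  ... | inj₁ e≡f                = inj₁ e≡f
  ... | inj₂ (inj₁ ef)          = inj₂ ef
  ... | inj₂ (inj₂ (f≢e , ¬fe)) = inj₂ (DistinctE-sym f e f≢e , λ c → ¬fe (HasCommonEdge-sym e f c))

  IsEOP⇒induced : IsEOP G D → VG G D x → VG G D y → Adj G x y → ∃ λ g → g ∈ D × SameEnds G g x y
  IsEOP⇒induced {x = x} {y} eop (e , e∈ , x∈e) (f , f∈ , y∈f) xy with IsEOP-∈ eop e∈ f∈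
  ... | inj₁ refl = e , e∈ , Endpoints⇒SameEnds e x∈e y∈f (Adj⇒≢ xy)
  ... | inj₂ (_ , ¬common) with SameEnds? e x y | SameEnds? f x y
  ...   | yes exy | _       = e , e∈ , exy
  ...   | no _    | yes fxy = f , f∈ , fxy
  ...   | no ¬exy | no ¬fxy = ⊥-elim (¬common (x , y , x∈e , y∈f , xy , ¬exy , ¬fxy))

  IsEOP-resp-↭ : ∀ {D D′} → D ↭ D′ → IsEOP G D → IsEOP G D′
  IsEOP-resp-↭ D↭ = Permutationₛ.AllPairs-resp-↭ (setoid (Edge G))
    (λ {e} {f} (e≢f , ¬common) → DistinctE-sym e f e≢f , λ c → ¬common (HasCommonEdge-sym f e c))
    ((λ { refl r → r }) , (λ { refl r → r })) (↭⇒↭ₛ D↭)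

  EOPOfSize : ℕ → Set
  EOPOfSize m = ∃ λ D → IsEOP G D × length D ≡ m

  EOPNumber≤ : ℕ → Set
  EOPNumber≤ k = ∀ D → IsEOP G D → length D ≤ k

  EOPNumber≤⇒≤ : EOPNumber≤ k → EOPOfSize m → m ≤ k
  EOPNumber≤⇒≤ bound (D , eop , refl) = bound D eop

  EOPNumber≤⇒¬EOPOfSize : EOPNumber≤ k → ¬ EOPOfSize (suc k)
  EOPNumber≤⇒¬EOPOfSize {k} bound eop = ℕₚ.n≮n k (EOPNumber≤⇒≤ bound eop)

  -- Star forests

  Pendant : (Fin n → Set) → Fin n → Fin n → Set
  Pendant S x y = ∀ w → S w → Adj G x w → w ≡ y

  StarForest : (Fin n → Set) → Set
  StarForest S = ∀ {x y} → S x → S y → Adj G x y → Pendant S x y ⊎ Pendant S y x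

  EdgeIn : (Fin n → Set) → Edge G → Set
  EdgeIn S e = ∀ x → Endpoint G e x → S x

  Pendant? : (∀ x → Dec (S x)) → ∀ x y → Dec (Pendant S x y)
  Pendant? S? x y = Finₚ.all? λ w → S? w →-dec (adj? x w →-dec (w Finₚ.≟ y))

  ¬Pendant⇒ : (∀ x → Dec (S x)) → ¬ Pendant S x y → ∃ λ w → S w × Adj G x w × w ≢ y
  ¬Pendant⇒ {x = x} {y} S? ¬x↦y
    with w , ¬h ← Finₚ.¬∀⟶∃¬ n _ (λ w → S? w →-dec (adj? x w →-dec (w Finₚ.≟ y))) ¬x↦y
    with S? w | adj? x w | w Finₚ.≟ y
  ... | yes sw  | yes xw  | no w≢y  = w , sw , xw , w≢y
  ... | yes _   | yes _   | yes w≡y = ⊥-elim (¬h λ _ _ → w≡y)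
  ... | yes _   | no ¬xw  | _       = ⊥-elim (¬h λ _ xw → ⊥-elim (¬xw xw))
  ... | no ¬sw  | _       | _       = ⊥-elim (¬h λ sw → ⊥-elim (¬sw sw))

  Pendant⇒SameEnds : ∀ e → EdgeIn S e → Endpoint G e x → Pendant S x y → SameEnds G e x y
  Pendant⇒SameEnds e e⊆S x∈e x↦y with x′ , exx′ ← partner e x∈e =
    subst (SameEnds G e _) (x↦y x′ (e⊆S x′ (proj₂ (SameEnds⇒Endpoints e exx′))) (SameEnds⇒Adj e exx′)) exx′

  StarForest⇒¬HasCommonEdge : StarForest S → ∀ e f → EdgeIn S e → EdgeIn S f → ¬ HasCommonEdge G e f
  StarForest⇒¬HasCommonEdge sf e f e⊆S f⊆S (x , y , x∈e , y∈f , xy , ¬exy , ¬fxy)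
    with sf (e⊆S x x∈e) (f⊆S y y∈f) xy
  ... | inj₁ x↦y = ¬exy (Pendant⇒SameEnds e e⊆S x∈e x↦y)
  ... | inj₂ y↦x = ¬fxy (SameEnds-sym f (Pendant⇒SameEnds f f⊆S y∈f y↦x))

  record EdgesIn (S : Fin n → Set) (m : ℕ) : Set where
    field
      edges    : List (Edge G)
      distinct : AllPairs (DistinctE G) edges
      inside   : All (EdgeIn S) edges
      size     : length edges ≡ m

  StarForest⇒IsEOP : StarForest S → AllPairs (DistinctE G) D → All (EdgeIn S) D → IsEOP G D
  StarForest⇒IsEOP sf []       []         = []
  StarForest⇒IsEOP {D = e ∷ _} sf (d ∷ ds) (e⊆S ∷ is) =
    All.zipWith (λ { {f} (e≢f , f⊆S) → e≢f , StarForest⇒¬HasCommonEdge sf e f e⊆S f⊆S }) (d , is)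
    ∷ StarForest⇒IsEOP sf ds is

  StarForest⇒EOP : StarForest S → EdgesIn S m → EOPOfSize m
  StarForest⇒EOP sf E = edges , StarForest⇒IsEOP sf distinct inside , size
    where open EdgesIn E

  IsEOP⇒¬path : IsEOP G D → ∀ g h → g ∈ D → h ∈ D → SameEnds G g u x → SameEnds G h y v →
                Adj G x y → u ≢ y → v ≢ x → ⊥
  IsEOP⇒¬path {x = x} {y = y} eop g h g∈ h∈ gux hyv xy u≢y v≢x with IsEOP-∈ eop g∈ h∈
  ... | inj₁ refl with SameEnds-unique g gux hyv
  ...   | inj₁ (u≡y , _) = u≢y u≡y
  ...   | inj₂ (_ , x≡y) = Adj⇒≢ xy x≡y
  IsEOP⇒¬path {x = x} {y = y} eop g h g∈ h∈ gux hyv xy u≢y v≢x | inj₂ (_ , ¬common) =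
    ¬common (x , y , proj₂ (SameEnds⇒Endpoints g gux) , proj₁ (SameEnds⇒Endpoints h hyv) , xy , ¬gxy , ¬hxy)
    where
    ¬gxy : ¬ SameEnds G g x y
    ¬gxy gxy with SameEnds-unique g gux gxy
    ... | inj₁ (_ , x≡y) = Adj⇒≢ xy x≡y
    ... | inj₂ (u≡y , _) = u≢y u≡y
    ¬hxy : ¬ SameEnds G h x y
    ¬hxy hxy with SameEnds-unique h hyv hxy
    ... | inj₁ (y≡x , _) = Adj⇒≢ xy (sym y≡x)
    ... | inj₂ (_ , v≡x) = v≢x v≡x

  IsEOP⇒StarForest : IsEOP G D → StarForest (VG G D)
  IsEOP⇒StarForest {D} eop {x} {y} x∈ y∈ xy with Pendant? (VG? D) x y | Pendant? (VG? D) y x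
  ... | yes x↦y | _       = inj₁ x↦y
  ... | no _    | yes y↦x = inj₂ y↦x
  ... | no ¬x↦y | no ¬y↦x =
    let u , u∈ , xu , u≢y = ¬Pendant⇒ (VG? D) ¬x↦y
        v , v∈ , yv , v≢x = ¬Pendant⇒ (VG? D) ¬y↦x
        g , g∈ , gux      = IsEOP⇒induced eop u∈ x∈ (Adj-sym xu)
        h , h∈ , hyv      = IsEOP⇒induced eop y∈ v∈ yv
    in ⊥-elim (IsEOP⇒¬path eop g h g∈ h∈ gux hyv xy u≢y v≢x)

  StarForest⇒¬triangle : StarForest S → S x → S y → S w → Adj G x y → Adj G y w → Adj G x w → ⊥
  StarForest⇒¬triangle sf sx sy sw xy yw xw with sf sx sy xy
  ... | inj₁ x↦y = Adj⇒≢ yw (sym (x↦y _ sw xw))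
  ... | inj₂ y↦x = Adj⇒≢ xw (sym (y↦x _ sw yw))

  StarForest-hub : ∀ p → (∀ {x} → S x → x ≢ p → ∃ λ q → Pendant S x q) → StarForest S
  StarForest-hub p pendant {x} {y} sx sy xy with x Finₚ.≟ p
  ... | no x≢p  = let q , x↦q = pendant sx x≢p in
                  inj₁ λ w sw xw → trans (x↦q w sw xw) (sym (x↦q y sy xy))
  ... | yes refl = let q , y↦q = pendant sy (λ y≡p → Adj⇒≢ xy (sym y≡p)) in
                   inj₂ λ w sw yw → trans (y↦q w sw yw) (sym (y↦q x sx (Adj-sym xy)))

  StarForest-∪ : StarForest S → StarForest T → (∀ {x y} → S x → T y → ¬ Adj G x y) →
                 StarForest (λ v → S v ⊎ T v)
  StarForest-∪ sfS sfT apart (inj₁ sx) (inj₁ sy) xy with sfS sx sy xy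
  ... | inj₁ x↦y = inj₁ λ { w (inj₁ sw) xw → x↦y w sw xw ; w (inj₂ tw) xw → ⊥-elim (apart sx tw xw) }
  ... | inj₂ y↦x = inj₂ λ { w (inj₁ sw) yw → y↦x w sw yw ; w (inj₂ tw) yw → ⊥-elim (apart sy tw yw) }
  StarForest-∪ sfS sfT apart (inj₂ tx) (inj₂ ty) xy with sfT tx ty xy
  ... | inj₁ x↦y = inj₁ λ { w (inj₂ tw) xw → x↦y w tw xw ; w (inj₁ sw) xw → ⊥-elim (apart sw tx (Adj-sym xw)) }
  ... | inj₂ y↦x = inj₂ λ { w (inj₂ tw) yw → y↦x w tw yw ; w (inj₁ sw) yw → ⊥-elim (apart sw ty (Adj-sym yw)) }
  StarForest-∪ sfS sfT apart (inj₁ sx) (inj₂ ty) xy = ⊥-elim (apart sx ty xy)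
  StarForest-∪ sfS sfT apart (inj₂ tx) (inj₁ sy) xy = ⊥-elim (apart sy tx (Adj-sym xy))

  EdgesIn-∪ : EdgesIn S m → EdgesIn T k → (∀ {x} → S x → ¬ T x) → EdgesIn (λ v → S v ⊎ T v) (m + k)
  EdgesIn-∪ {S = S} {T = T} E F disjoint = record
    { edges    = E.edges ++ F.edges
    ; distinct = AllPairsₚ.++⁺ E.distinct F.distinct
                   (All.map (λ {e} e⊆S → All.map (λ {f} f⊆T → Endpoint⇒DistinctE e f (inj₁ refl)
                                                    λ lo∈f → disjoint (e⊆S _ (inj₁ refl)) (f⊆T _ lo∈f))
                                              F.inside)
                            E.inside)
    ; inside   = Allₚ.++⁺ (All.map (λ e⊆S x x∈e → inj₁ (e⊆S x x∈e)) E.inside)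
                          (All.map (λ f⊆T x x∈f → inj₂ (f⊆T x x∈f)) F.inside)
    ; size     = trans (Listₚ.length-++ E.edges) (cong₂ _+_ E.size F.size)
    }
    where
    module E = EdgesIn E
    module F = EdgesIn F

  AllPairs-¬Adj : ∀ {L} → AllPairs (λ x y → ¬ Adj G x y) L → x ∈ L → y ∈ L → ¬ Adj G x y
  AllPairs-¬Adj indep x∈ y∈ xy with AllPairs-∈ indep x∈ y∈
  ... | inj₁ refl        = Adj-irrefl xy
  ... | inj₂ (inj₁ ¬xy) = ¬xy xy
  ... | inj₂ (inj₂ ¬yx) = ¬yx (Adj-sym xy)

  StarOn : Fin n → List (Fin n) → Fin n → Set
  StarOn c L v = v ≡ c ⊎ v ∈ L

  spokes : ∀ L → All (Adj G c) L → List (Edge G)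
  spokes []      []        = []
  spokes (_ ∷ L) (cx ∷ cL) = edgeOf cx ∷ spokes L cL

  spokes-∈ : ∀ L (cL : All (Adj G c) L) → e ∈ spokes L cL → ∃ λ x → x ∈ L × SameEnds G e c x
  spokes-∈ (x ∷ L) (cx ∷ cL) (here refl) = x , here refl , edgeOf-ends cx
  spokes-∈ (x ∷ L) (cx ∷ cL) (there e∈)  = let y , y∈ , ecy = spokes-∈ L cL e∈ in y , there y∈ , ecy

  spokes-length : ∀ L (cL : All (Adj G c) L) → length (spokes L cL) ≡ length L
  spokes-length []      []        = refl
  spokes-length (_ ∷ L) (_ ∷ cL) = cong suc (spokes-length L cL)

  spokes-distinct : ∀ L (cL : All (Adj G c) L) → Unique L → AllPairs (DistinctE G) (spokes L cL)
  spokes-distinct []      []        []          = []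
  spokes-distinct {c} (x ∷ L) (cx ∷ cL) (x∉L ∷ uL) = All.tabulate new ∷ spokes-distinct L cL uL
    where
    new : f ∈ spokes L cL → DistinctE G (edgeOf cx) f
    new {f} f∈ with y , y∈ , fcy ← spokes-∈ L cL f∈ =
      Endpoint⇒DistinctE (edgeOf cx) f (proj₂ (SameEnds⇒Endpoints (edgeOf cx) (edgeOf-ends cx))) λ x∈f →
        [ (λ x≡c → Adj⇒≢ cx (sym x≡c)) , All.lookup x∉L y∈ ]′ (SameEnds-Endpoint f fcy x∈f)

  star : ∀ c L → Unique L → (cL : All (Adj G c) L) → AllPairs (λ x y → ¬ Adj G x y) L →
         StarForest (StarOn c L) × EdgesIn (StarOn c L) (length L)
  star c L uL cL indep = StarForest-hub c leaf , record
    { edges    = spokes L cL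
    ; distinct = spokes-distinct L cL uL
    ; inside   = All.tabulate inside
    ; size     = spokes-length L cL
    }
    where
    leaf : StarOn c L x → x ≢ c → ∃ λ q → Pendant (StarOn c L) x q
    leaf (inj₁ x≡c) x≢c = ⊥-elim (x≢c x≡c)
    leaf (inj₂ x∈)  _   = c , λ { w (inj₁ w≡c) _ → w≡c ; w (inj₂ w∈) xw → ⊥-elim (AllPairs-¬Adj indep x∈ w∈ xw) }
    inside : e ∈ spokes L cL → EdgeIn (StarOn c L) e
    inside {e} e∈ x x∈e with y , y∈ , ecy ← spokes-∈ L cL e∈ =
      [ inj₁ , (λ { refl → inj₂ y∈ }) ]′ (SameEnds-Endpoint e ecy x∈e)

  StarForest-addLeaf : StarForest S → (∀ w → S w → Adj G z w → w ≡ c) → (∀ y → S y → Adj G c y → Pendant S y c) →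
                       StarForest (λ v → S v ⊎ v ≡ z)
  StarForest-addLeaf {S = S} {z = z} {c = c} sf z↦c c↤ = sf′
    where
    S′ : Fin n → Set
    S′ v = S v ⊎ v ≡ z
    lift : ∀ {q} → Pendant S x q → ¬ Adj G x z → Pendant S′ x q
    lift x↦q ¬xz w (inj₁ sw)   xw = x↦q w sw xw
    lift x↦q ¬xz w (inj₂ refl) xz = ⊥-elim (¬xz xz)
    away : S x → x ≢ c → ¬ Adj G x z
    away sx x≢c xz = x≢c (z↦c _ sx (Adj-sym xz))
    z↦c′ : Pendant S′ z c
    z↦c′ w (inj₁ sw)   zw = z↦c w sw zw
    z↦c′ w (inj₂ refl) zz = ⊥-elim (Adj-irrefl zz)
    sf′ : StarForest S′
    sf′ {x} {y} (inj₁ sx) (inj₁ sy) xy with x Finₚ.≟ c | y Finₚ.≟ c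
    ... | yes refl | _        = inj₂ (lift (c↤ y sy xy) (away sy λ y≡c → Adj⇒≢ xy (sym y≡c)))
    ... | no _     | yes refl = inj₁ (lift (c↤ x sx (Adj-sym xy)) (away sx (Adj⇒≢ xy)))
    ... | no x≢c   | no y≢c   =
      [ (λ x↦y → inj₁ (lift x↦y (away sx x≢c))) , (λ y↦x → inj₂ (lift y↦x (away sy y≢c))) ]′ (sf sx sy xy)
    sf′ (inj₂ refl) (inj₁ sy)   zy with refl ← z↦c _ sy zy = inj₁ z↦c′
    sf′ (inj₁ sx)   (inj₂ refl) xz with refl ← z↦c _ sx (Adj-sym xz) = inj₂ z↦c′
    sf′ (inj₂ refl) (inj₂ refl) zz = ⊥-elim (Adj-irrefl zz)

  IsEOP-extend : IsEOP G D → ¬ VG G D z → VG G D c → Adj G z c → (∀ w → VG G D w → Adj G z w → w ≡ c) →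
                 (∀ y → VG G D y → Adj G c y → Pendant (VG G D) y c) → EOPOfSize (suc (length D))
  IsEOP-extend {D = D} eop z∉ c∈ zc z↦c c↤ =
    StarForest⇒EOP (StarForest-addLeaf (IsEOP⇒StarForest eop) z↦c c↤) record
      { edges    = edgeOf zc ∷ D
      ; distinct = All.tabulate (λ {e} e∈ → Endpoint⇒DistinctE (edgeOf zc) e z∈ λ z∈e → z∉ (e , e∈ , z∈e))
                   ∷ AllPairs.map proj₁ eop
      ; inside   = (λ x x∈ → [ (λ { refl → inj₂ refl }) , (λ { refl → inj₁ c∈ }) ]′
                               (SameEnds-Endpoint (edgeOf zc) (edgeOf-ends zc) x∈))
                   ∷ All.tabulate (λ e∈ x x∈e → inj₁ (_ , e∈ , x∈e))
      ; size     = refl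
      }
    where
    z∈ = proj₁ (SameEnds⇒Endpoints (edgeOf zc) (edgeOf-ends zc))

  -- Induced matchings and vertices of degree two

  IsInducedMatching⇒same : IsInducedMatching G M → e ∈ M → f ∈ M → Endpoint G e x → Endpoint G f y →
                           Adj G x y → e ≡ f
  IsInducedMatching⇒same {x = x} {y = y} im e∈ f∈ x∈e y∈f xy with AllPairs-∈ im e∈ f∈
  ... | inj₁ e≡f     = e≡f
  ... | inj₂ (inj₁ r) = ⊥-elim (proj₂ (r x y x∈e y∈f) xy)
  ... | inj₂ (inj₂ r) = ⊥-elim (proj₂ (r y x y∈f x∈e) (Adj-sym xy))

  IsInducedMatching⇒SameEnds : IsInducedMatching G M → e ∈ M → Endpoint G e x → VG G M y → Adj G x y →
                               SameEnds G e x y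
  IsInducedMatching⇒SameEnds {e = e} im e∈ x∈e (f , f∈ , y∈f) xy
    with refl ← IsInducedMatching⇒same im e∈ f∈ x∈e y∈f xy = Endpoints⇒SameEnds e x∈e y∈f (Adj⇒≢ xy)

  IsInducedMatching⇒Pendant : IsInducedMatching G M → VG G M x → VG G M y → Adj G x y → Pendant (VG G M) x y
  IsInducedMatching⇒Pendant im (e , e∈ , x∈e) y∈ xy u u∈ xu
    with SameEnds-unique e (IsInducedMatching⇒SameEnds im e∈ x∈e u∈ xu) (IsInducedMatching⇒SameEnds im e∈ x∈e y∈ xy)
  ... | inj₁ (_ , u≡y) = u≡y
  ... | inj₂ (x≡y , _) = ⊥-elim (Adj⇒≢ xy x≡y)

  IsInducedMatching⇒IsEOP : IsInducedMatching G M → IsEOP G M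
  IsInducedMatching⇒IsEOP {M} im =
    StarForest⇒IsEOP (λ x∈ y∈ xy → inj₁ (IsInducedMatching⇒Pendant im x∈ y∈ xy))
      (AllPairs.map (λ {e} r (lo≡ , _) → proj₁ (r (lo e) _ (inj₁ refl) (inj₁ refl)) lo≡) im)
      (All.tabulate λ e∈ x x∈e → _ , e∈ , x∈e)

  -- pw together with M, each edge of M touched by p turned into the edge from p to the touched endpoint,
  -- is an EOP set in which every vertex other than p is a leaf.
  module _ {M : List (Edge G)} {p w : Fin n} (im : IsInducedMatching G M) (pw : Adj G p w)
           (w-far : ∀ y → VG G M y → ¬ Adj G w y) where

    private
      redirect : Edge G → Edge G
      redirect f with adj? p (lo f) | adj? p (hi f)
      ... | yes pa | _      = edgeOf pa
      ... | no _   | yes pa = edgeOf pa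
      ... | no _   | no _   = f

      redirect-spec : ∀ f → (∃ λ a → Endpoint G f a × SameEnds G (redirect f) p a)
                          ⊎ (redirect f ≡ f × (∀ x → Endpoint G f x → ¬ Adj G p x))
      redirect-spec f with adj? p (lo f) | adj? p (hi f)
      ... | yes pa  | _       = inj₁ (lo f , inj₁ refl , edgeOf-ends pa)
      ... | no _    | yes pa  = inj₁ (hi f , inj₂ refl , edgeOf-ends pa)
      ... | no ¬plo | no ¬phi = inj₂ (refl , λ { x (inj₁ refl) → ¬plo ; x (inj₂ refl) → ¬phi })

      p∉M : ¬ VG G M p
      p∉M p∈ = w-far _ p∈ (Adj-sym pw)

      w∉M : ¬ VG G M w
      w∉M (f , f∈ , w∈f) with w′ , fww′ ← partner f w∈f =
        w-far w′ (f , f∈ , proj₂ (SameEnds⇒Endpoints f fww′)) (SameEnds⇒Adj f fww′)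

      redirect-Endpoint : ∀ f → Endpoint G (redirect f) x → x ≡ p ⊎ Endpoint G f x
      redirect-Endpoint {x} f x∈ with redirect-spec f
      ... | inj₁ (a , a∈f , fpa) = [ inj₁ , (λ { refl → inj₂ a∈f }) ]′ (SameEnds-Endpoint (redirect f) fpa x∈)
      ... | inj₂ (eq , _)        = inj₂ (subst (λ g → Endpoint G g x) eq x∈)

      redirect-Endpoint′ : ∀ f → Endpoint G (redirect f) x → x ≢ p → Endpoint G f x
      redirect-Endpoint′ f x∈ x≢p = [ (λ x≡p → ⊥-elim (x≢p x≡p)) , (λ x∈f → x∈f) ]′ (redirect-Endpoint f x∈)

      redirect-owns : ∀ f → ∃ λ x → Endpoint G (redirect f) x × Endpoint G f x
      redirect-owns f with redirect-spec f
      ... | inj₁ (a , a∈f , fpa) = a , proj₂ (SameEnds⇒Endpoints (redirect f) fpa) , a∈f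
      ... | inj₂ (eq , _)        = lo f , subst (λ g → Endpoint G g (lo f)) (sym eq) (inj₁ refl) , inj₁ refl

      Kept : Fin n → Set
      Kept x = ∃ λ f → f ∈ M × Endpoint G (redirect f) x × x ≢ p

      Covered : Fin n → Set
      Covered x = x ≡ p ⊎ x ≡ w ⊎ Kept x

      w↦p : Pendant Covered w p
      w↦p u (inj₁ u≡p)                       _  = u≡p
      w↦p u (inj₂ (inj₁ refl))               ww = ⊥-elim (Adj-irrefl ww)
      w↦p u (inj₂ (inj₂ (f , f∈ , u∈ , u≢p))) wu = ⊥-elim (w-far u (f , f∈ , redirect-Endpoint′ f u∈ u≢p) wu)

      kept-pendant : Kept x → ∃ λ q → Pendant Covered x q
      kept-pendant {x} (f , f∈ , x∈ , x≢p) with redirect-Endpoint′ f x∈ x≢p | redirect-spec f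
      ... | x∈f | inj₁ (a , a∈f , fpa) = p , x↦p
        where
        x↦p : Pendant Covered x p
        x↦p u (inj₁ u≡p)                       _  = u≡p
        x↦p u (inj₂ (inj₁ refl))               xw = ⊥-elim (w-far x (f , f∈ , x∈f) (Adj-sym xw))
        x↦p u (inj₂ (inj₂ (g , g∈ , u∈ , u≢p))) xu
          with refl ← IsInducedMatching⇒same im f∈ g∈ x∈f (redirect-Endpoint′ g u∈ u≢p) xu =
          ⊥-elim (Adj⇒≢ xu (trans (only x∈ x≢p) (sym (only u∈ u≢p))))
          where
          only : ∀ {v} → Endpoint G (redirect f) v → v ≢ p → v ≡ a
          only v∈ v≢p = [ (λ v≡p → ⊥-elim (v≢p v≡p)) , (λ v≡a → v≡a) ]′ (SameEnds-Endpoint (redirect f) fpa v∈)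
      ... | x∈f | inj₂ (_ , ¬p-f) with x′ , fxx′ ← partner f x∈f = x′ , x↦x′
        where
        x↦x′ : Pendant Covered x x′
        x↦x′ u (inj₁ refl)                      xp = ⊥-elim (¬p-f x x∈f (Adj-sym xp))
        x↦x′ u (inj₂ (inj₁ refl))               xw = ⊥-elim (w-far x (f , f∈ , x∈f) (Adj-sym xw))
        x↦x′ u (inj₂ (inj₂ (g , g∈ , u∈ , u≢p))) xu
          with u∈g ← redirect-Endpoint′ g u∈ u≢p
          with refl ← IsInducedMatching⇒same im f∈ g∈ x∈f u∈g xu
          with SameEnds-Endpoint f fxx′ u∈g
        ... | inj₁ u≡x  = ⊥-elim (Adj⇒≢ xu (sym u≡x))
        ... | inj₂ u≡x′ = u≡x′

      one : Covered x → x ≢ p → ∃ λ q → Pendant Covered x q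
      one (inj₁ x≡p)         x≢p = ⊥-elim (x≢p x≡p)
      one (inj₂ (inj₁ refl)) _   = p , w↦p
      one (inj₂ (inj₂ kept)) _   = kept-pendant kept

      redirect-distinct : ∀ {f g} → f ∈ M → g ∈ M → (∀ x y → Endpoint G f x → Endpoint G g y → x ≢ y × ¬ Adj G x y) →
                 DistinctE G (redirect f) (redirect g)
      redirect-distinct {f} {g} f∈ g∈ apart with x , x∈rf , x∈f ← redirect-owns f =
        Endpoint⇒DistinctE (redirect f) (redirect g) x∈rf λ x∈rg →
          [ (λ { refl → p∉M (f , f∈ , x∈f) }) , (λ x∈g → proj₁ (apart _ _ x∈f x∈g) refl) ]′ (redirect-Endpoint g x∈rg)

      redirect-inside : ∀ {f} → f ∈ M → EdgeIn Covered (redirect f)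
      redirect-inside {f} f∈ x x∈ with x Finₚ.≟ p
      ... | yes x≡p = inj₁ x≡p
      ... | no x≢p  = inj₂ (inj₂ (f , f∈ , x∈ , x≢p))

    IsInducedMatching-redirect : EOPOfSize (suc (length M))
    IsInducedMatching-redirect = StarForest⇒EOP (StarForest-hub p one) record
      { edges    = edgeOf pw ∷ map redirect M
      ; distinct = Allₚ.map⁺ (All.tabulate λ {f} f∈ →
                     Endpoint⇒DistinctE (edgeOf pw) (redirect f) w∈ λ w∈rf →
                       [ (λ w≡p → Adj⇒≢ pw (sym w≡p)) , (λ w∈f → w∉M (f , f∈ , w∈f)) ]′ (redirect-Endpoint f w∈rf))
                   ∷ AllPairsₚ.map⁺ (AllPairs-mapWith∈ M redirect-distinct im)
      ; inside   = (λ x x∈ → [ inj₁ , (λ x≡w → inj₂ (inj₁ x≡w)) ]′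
                               (SameEnds-Endpoint (edgeOf pw) (edgeOf-ends pw) x∈))
                   ∷ Allₚ.map⁺ (All.tabulate redirect-inside)
      ; size     = cong suc (Listₚ.length-map redirect M)
      }
      where
      w∈ = proj₂ (SameEnds⇒Endpoints (edgeOf pw) (edgeOf-ends pw))

  HasDegree2 : List (Edge G) → Set
  HasDegree2 D = ∃ λ v → ∃ λ x → ∃ λ y → VG G D v × VG G D x × VG G D y × Adj G v x × Adj G v y × x ≢ y

  HasDegree2? : ∀ D → Dec (HasDegree2 D)
  HasDegree2? D = Finₚ.any? λ v → Finₚ.any? λ x → Finₚ.any? λ y →
    VG? D v ×-dec VG? D x ×-dec VG? D y ×-dec adj? v x ×-dec adj? v y ×-dec ¬? (x Finₚ.≟ y)

  HasDegree2⇒Pendant : IsEOP G D → VG G D u → VG G D x → VG G D y → Adj G u x → Adj G u y → x ≢ y →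
                       ∀ v → VG G D v → Adj G u v → Pendant (VG G D) v u
  HasDegree2⇒Pendant eop u∈ x∈ y∈ ux uy x≢y v v∈ uv with IsEOP⇒StarForest eop u∈ v∈ uv
  ... | inj₁ u↦v = ⊥-elim (x≢y (trans (u↦v _ x∈ ux) (sym (u↦v _ y∈ uy))))
  ... | inj₂ v↦u = v↦u

  ¬HasDegree2⇒IsInducedMatching : IsEOP G D → ¬ HasDegree2 D → IsInducedMatching G D
  ¬HasDegree2⇒IsInducedMatching {D} eop ¬deg2 = AllPairs-mapWith∈ D (λ e∈ f∈ → apart e∈ f∈ ∘ proj₁) eop
    where
    unique-neighbour : VG G D v → VG G D x → VG G D y → Adj G v x → Adj G v y → x ≡ y
    unique-neighbour {x = x} {y} v∈ x∈ y∈ vx vy with x Finₚ.≟ y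
    ... | yes x≡y = x≡y
    ... | no x≢y  = ⊥-elim (¬deg2 (_ , x , y , v∈ , x∈ , y∈ , vx , vy , x≢y))
    partner-SameEnds : e ∈ D → Endpoint G e x → VG G D y → Adj G x y → SameEnds G e x y
    partner-SameEnds {e} e∈ x∈e y∈ xy with x′ , exx′ ← partner e x∈e =
      subst (SameEnds G e _) (unique-neighbour (e , e∈ , x∈e) (e , e∈ , proj₂ (SameEnds⇒Endpoints e exx′)) y∈
                                                (SameEnds⇒Adj e exx′) xy) exx′
    apart : ∀ {e f} → e ∈ D → f ∈ D → DistinctE G e f →
            ∀ x y → Endpoint G e x → Endpoint G f y → x ≢ y × ¬ Adj G x y
    apart {e} {f} e∈ f∈ e≢f x y x∈e y∈f = x≢y , ¬xy
      where
      x≢y : x ≢ y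
      x≢y refl with x′ , fxx′ ← partner f y∈f =
        let x′∈ = (f , f∈ , proj₂ (SameEnds⇒Endpoints f fxx′)) in
        SameEnds⇒¬DistinctE e f (partner-SameEnds e∈ x∈e x′∈ (SameEnds⇒Adj f fxx′)) fxx′ e≢f
      ¬xy : ¬ Adj G x y
      ¬xy xy = SameEnds⇒¬DistinctE e f (partner-SameEnds e∈ x∈e (f , f∈ , y∈f) xy)
                 (SameEnds-sym f (partner-SameEnds f∈ y∈f (e , e∈ , x∈e) (Adj-sym xy))) e≢f

  module _ {D : List (Edge G)} {s : ℕ} {r : Fin s → ℕ} (SC : StarComponents G D s r) where
    open StarComponents SC

    InComp-adjacent : ∀ i → InComp G centre leaves i x → VG G D y → Adj G x y → InComp G centre leaves i y
    InComp-adjacent {x} {y} i x∈i y∈ xy with j , y∈j ← cover y y∈ with j Finₚ.≟ i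
    ... | yes refl = y∈j
    ... | no j≢i   = ⊥-elim (separated i j x y (λ i≡j → j≢i (sym i≡j)) x∈i y∈j xy)

    centre-neighbour-Pendant : ∀ j → VG G D y → Adj G (centre j) y → Pendant (VG G D) y (centre j)
    centre-neighbour-Pendant j y∈ cy u u∈ yu
      with InComp-adjacent j (inj₁ refl) y∈ cy
    ... | inj₁ refl = ⊥-elim (Adj-irrefl cy)
    ... | inj₂ y∈L with InComp-adjacent j (inj₂ y∈L) u∈ yu
    ...   | inj₁ u≡c = u≡c
    ...   | inj₂ u∈L = ⊥-elim (AllPairs-¬Adj (leavesIndep j) y∈L u∈L yu)

    HasDegree2⇒large-component : HasDegree2 D → ∃ λ i → 2 ≤ r i
    HasDegree2⇒large-component (v , x , y , v∈ , x∈ , y∈ , vx , vy , x≢y)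
      with i , v∈i ← cover v v∈
      with InComp-adjacent i v∈i x∈ vx | InComp-adjacent i v∈i y∈ vy | v∈i
    ... | inj₂ x∈L | inj₂ y∈L | inj₁ refl = i , subst (2 ≤_) (leavesCount i) (2≤length x∈L y∈L x≢y)
    ... | inj₁ refl | _        | inj₁ refl = ⊥-elim (Adj-irrefl vx)
    ... | _        | inj₁ refl | inj₁ refl = ⊥-elim (Adj-irrefl vy)
    ... | inj₁ x≡c | inj₁ y≡c  | inj₂ _   = ⊥-elim (x≢y (trans x≡c (sym y≡c)))
    ... | inj₂ x∈L | _         | inj₂ v∈L = ⊥-elim (AllPairs-¬Adj (leavesIndep i) v∈L x∈L vx)
    ... | _        | inj₂ y∈L  | inj₂ v∈L = ⊥-elim (AllPairs-¬Adj (leavesIndep i) v∈L y∈L vy)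

    InComp-other : ∀ {i j} → InComp G centre leaves i w → w ≢ centre j → ¬ Adj G (centre j) w → i ≢ j
    InComp-other (inj₁ w≡c) w≢c _   refl = w≢c w≡c
    InComp-other {j = j} (inj₂ w∈L) _   ¬cw refl = ¬cw (All.lookup (centreAdj j) w∈L)

  IsPartition⇒suc≤ : ∀ {s r} → IsPartition G k s r → ∀ i → 2 ≤ r i → suc s ≤ k
  IsPartition⇒suc≤ {s = s} {r} (positive , _ , sum≡k) i 2≤ri =
    subst₂ (λ m k → suc m ≤ k) (Listₚ.length-tabulate id) sum≡k
      (suc-length≤sum r (All.tabulate λ {j} _ → positive j) (∈-allFin i) 2≤ri)

  -- Distances

  DistLe-refl : DistLe G x x 0
  DistLe-refl = 0 , z≤n , here

  DistLe-step : Adj G x y → DistLe G y z d → DistLe G x z (suc d)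
  DistLe-step xy (L , L≤d , walk) = suc L , s≤s L≤d , step xy walk

  DistLe-mono : ∀ {d′} → d ≤ d′ → DistLe G x y d → DistLe G x y d′
  DistLe-mono d≤d′ (L , L≤d , walk) = L , ℕₚ.≤-trans L≤d d≤d′ , walk

  DistLe-trans : ∀ {d′} → DistLe G x y d → DistLe G y z d′ → DistLe G x z (d + d′)
  DistLe-trans {d = d} {d′ = d′} (_ , z≤n , here) yz = DistLe-mono (ℕₚ.m≤n+m d′ d) yz
  DistLe-trans (suc L , s≤s L≤d , step xw walk) yz = DistLe-step xw (DistLe-trans (L , L≤d , walk) yz)

  DistLe-uncons : DistLe G x z (suc d) → x ≢ z → ∃ λ y → Adj G x y × DistLe G y z d
  DistLe-uncons (zero  , _        , here)        x≢z = ⊥-elim (x≢z refl)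
  DistLe-uncons (suc L , s≤s L≤d , step xy walk) _   = _ , xy , L , L≤d , walk

  DistLe-0 : DistLe G x y 0 → x ≡ y
  DistLe-0 (zero , _ , here) = refl

  DistLe-1 : DistLe G x y 1 → x ≡ y ⊎ Adj G x y
  DistLe-1 (zero , _ , here)                 = inj₁ refl
  DistLe-1 (suc zero , _ , step xy here)     = inj₂ xy
  DistLe-1 (suc (suc _) , s≤s () , _)

  walk? : ∀ x y L → Dec (Walk G x y L)
  walk? x y zero with x Finₚ.≟ y
  ... | yes refl = yes here
  ... | no x≢y   = no λ { here → x≢y refl }
  walk? x y (suc L) = map′ (λ (w , xw , walk) → step xw walk) (λ { (step xw walk) → _ , xw , walk })
                           (Finₚ.any? λ w → adj? x w ×-dec walk? w y L)

  DistLe? : ∀ x y d → Dec (DistLe G x y d)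
  DistLe? x y d = map′ (λ (i , walk) → toℕ i , ℕₚ.≤-pred (Finₚ.toℕ<n i) , walk)
                       (λ (L , L≤d , walk) → fromℕ< (s≤s L≤d) , subst (Walk G x y) (sym (Finₚ.toℕ-fromℕ< _)) walk)
                       (Finₚ.any? λ (i : Fin (suc d)) → walk? x y (toℕ i))

  Walk-crossing : {P : Fin n → Set} → (∀ x → Dec (P x)) → ∀ {L} → Walk G x y L → ¬ P x → P y →
                  ∃ λ a → ∃ λ b → Adj G a b × ¬ P a × P b
  Walk-crossing P? here ¬px py = ⊥-elim (¬px py)
  Walk-crossing P? (step {w = w} xw walk) ¬px py with P? w
  ... | yes pw = _ , w , xw , ¬px , pw
  ... | no ¬pw = Walk-crossing P? walk ¬pw py

  geodesic-P3 : ∀ d → DistLe G u v (3 + d) → ¬ DistLe G u v (2 + d) →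
                ∃ λ p → ∃ λ q → StarForest (StarOn p (u ∷ q ∷ [])) × EdgesIn (StarOn p (u ∷ q ∷ [])) 2
                              × (∀ {x} → StarOn p (u ∷ q ∷ []) x → DistLe G u x 2 × DistLe G x v (3 + d))
                              × DistLe G q v (1 + d)
  geodesic-P3 {u} {v} d uv ¬uv
    with p , up , pv ← DistLe-uncons uv (λ { refl → ¬uv (DistLe-mono z≤n DistLe-refl) })
    with q , pq , qv ← DistLe-uncons pv (λ { refl → ¬uv (DistLe-mono (s≤s z≤n) (DistLe-step up DistLe-refl)) }) =
    let sf , E = star p (u ∷ q ∷ [])
                   (((λ { refl → ¬uv (DistLe-mono (ℕₚ.n≤1+n _) qv) }) ∷ []) ∷ [] ∷ [])
                   (Adj-sym up ∷ pq ∷ [])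
                   (((λ uq → ¬uv (DistLe-step uq qv)) ∷ []) ∷ [] ∷ [])
    in p , q , sf , E , distances , qv
    where
    distances : ∀ {x} → StarOn p (u ∷ q ∷ []) x → DistLe G u x 2 × DistLe G x v (3 + d)
    distances (inj₁ refl)               = DistLe-mono (s≤s z≤n) (DistLe-step up DistLe-refl) , DistLe-mono (ℕₚ.n≤1+n _) pv
    distances (inj₂ (here refl))        = DistLe-mono z≤n DistLe-refl , uv
    distances (inj₂ (there (here refl))) = DistLe-step up (DistLe-step pq DistLe-refl) ,
                                           DistLe-mono (ℕₚ.m≤n⇒m≤1+n (ℕₚ.n≤1+n _)) qv

  -- Along a shortest u-v path u p₁ p₂ … of length 2k+1, take the stars p₁p₀, p₁p₂, then p₅p₄, p₅p₆, …
  geodesic⇒StarForest : ∀ k → DistLe G u v (suc (2 * k)) → ¬ DistLe G u v (2 * k) →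
                        ∃ λ S → StarForest S × EdgesIn S (suc k) × (∀ {x} → S x → DistLe G x v (suc (2 * k)))
  geodesic⇒StarForest {u} {v} zero uv ¬uv
    with p , up , pv ← DistLe-uncons uv (λ { refl → ¬uv DistLe-refl })
    with refl ← DistLe-0 pv =
    let sf , E = star u (v ∷ []) ([] ∷ []) (up ∷ []) ([] ∷ []) in
    StarOn u (v ∷ []) , sf , E , λ { (inj₁ refl) → uv ; (inj₂ (here refl)) → DistLe-mono z≤n DistLe-refl }
  geodesic⇒StarForest (suc zero) uv ¬uv =
    let p , q , sf , E , distances , _ = geodesic-P3 0 uv ¬uv in
    StarOn p (_ ∷ q ∷ []) , sf , E , λ x∈ → proj₂ (distances x∈)
  geodesic⇒StarForest {u} {v} (suc (suc k)) uv ¬uv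
    rewrite ℕₚ.*-distribˡ-+ 2 2 k
    with p , q , sf₃ , E₃ , distances , qv ← geodesic-P3 (2 + 2 * k) uv ¬uv
    with uq ← proj₁ (distances (inj₂ (there (here refl))))
    with r , qr , rv ← DistLe-uncons qv (λ { refl → ¬uv (DistLe-mono (s≤s (s≤s z≤n)) uq) })
    with s , rs , sv ← DistLe-uncons rv (λ { refl → ¬uv (DistLe-mono (s≤s (s≤s (s≤s z≤n))) (DistLe-trans uq (DistLe-step qr DistLe-refl))) })
    with us ← DistLe-trans uq (DistLe-step qr (DistLe-step rs DistLe-refl))
    with S′ , sf′ , E′ , near′ ← geodesic⇒StarForest k sv (λ sv′ → ¬uv (DistLe-trans us sv′)) =
    _ , StarForest-∪ sf₃ sf′ (λ x∈ y∈ xy → ¬uv (DistLe-trans (proj₁ (distances x∈)) (DistLe-step xy (near′ y∈))))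
      , EdgesIn-∪ E₃ E′ (λ x∈ x∈′ → ¬uv (DistLe-mono (ℕₚ.n≤1+n _) (DistLe-trans (proj₁ (distances x∈)) (near′ x∈′))))
      , λ { (inj₁ x∈) → proj₂ (distances x∈) ; (inj₂ x∈′) → DistLe-mono (ℕₚ.m≤n+m _ 4) (near′ x∈′) }

  -- Consequences of an upper bound on the EOP number

  EOPNumber≤⇒C₂ : EOPNumber≤ k → C₂ G k
  EOPNumber≤⇒C₂ {k} bound s k<s (c , L , uL , refl , cL , indep) =
    let sf , E = star c L uL cL indep in
    ℕₚ.n≮n k (ℕₚ.≤-trans (subst (_≤ s) (ℕₚ.+-comm k 1) k<s) (EOPNumber≤⇒≤ bound (StarForest⇒EOP sf E)))

  AnotherNeighbour : List (Edge G) → Fin n → Fin n → Set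
  AnotherNeighbour D z c = ∃ λ y → VG G D y × y ≢ c × Adj G z y

  AnotherNeighbour? : ∀ D z c → Dec (AnotherNeighbour D z c)
  AnotherNeighbour? D z c = Finₚ.any? λ y → VG? D y ×-dec ¬? (y Finₚ.≟ c) ×-dec adj? z y

  ¬AnotherNeighbour⇒ : ¬ AnotherNeighbour D z c → ∀ w → VG G D w → Adj G z w → w ≡ c
  ¬AnotherNeighbour⇒ {c = c} ¬other w w∈ zw with w Finₚ.≟ c
  ... | yes w≡c = w≡c
  ... | no w≢c  = ⊥-elim (¬other (w , w∈ , w≢c , zw))

  EOPNumber≤⇒C₃ : Connected G → EOPNumber≤ k → 1 ≤ k → C₃ G k
  EOPNumber≤⇒C₃ conn bound _ M im refl z z∉ with Finₚ.any? (λ x → VG? M x ×-dec adj? z x)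
  ... | yes (x , x∈ , zx) with AnotherNeighbour? M z x
  ...   | yes (y , y∈ , y≢x , zy) = x , y , (λ x≡y → y≢x (sym x≡y)) , x∈ , y∈ , zx , zy
  ...   | no ¬other = ⊥-elim (EOPNumber≤⇒¬EOPOfSize bound
            (IsEOP-extend (IsInducedMatching⇒IsEOP im) z∉ x∈ zx (¬AnotherNeighbour⇒ ¬other)
                          (λ y y∈ xy → IsInducedMatching⇒Pendant im y∈ x∈ (Adj-sym xy))))
  EOPNumber≤⇒C₃ conn bound (s≤s z≤n) (e ∷ M) im refl z z∉ | no ¬near with conn z (lo e)
  ... | zero  , here          = ⊥-elim (z∉ (e , here refl , inj₁ refl))
  ... | suc _ , step zp _     = ⊥-elim (EOPNumber≤⇒¬EOPOfSize bound
            (IsInducedMatching-redirect im (Adj-sym zp) λ y y∈ zy → ¬near (y , y∈ , zy)))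

  EOPNumber≤⇒C₄ : EOPNumber≤ k → C₄ G k
  EOPNumber≤⇒C₄ bound s _ _ r _ D eop refl SC j z z∉ zc with AnotherNeighbour? D z (StarComponents.centre SC j)
  ... | yes other = other
  ... | no ¬other = ⊥-elim (EOPNumber≤⇒¬EOPOfSize bound
          (IsEOP-extend eop z∉ (StarComponents.within SC j _ (inj₁ refl)) zc (¬AnotherNeighbour⇒ ¬other)
                        (λ y y∈ cy → centre-neighbour-Pendant SC j y∈ cy)))

  EOPNumber≤⇒DiamAtMost : Connected G → EOPNumber≤ k → DiamAtMost G (2 * k)
  EOPNumber≤⇒DiamAtMost {k} conn bound u v with DistLe? u v (2 * k)
  ... | yes uv = uv
  ... | no ¬uv
    with a , b , ab , ¬av , bv ← Walk-crossing (λ x → DistLe? x v (2 * k)) (proj₂ (conn u v)) ¬uv (DistLe-mono z≤n DistLe-refl)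
    with S , sf , E , _ ← geodesic⇒StarForest k (DistLe-step ab bv) ¬av =
    ⊥-elim (EOPNumber≤⇒¬EOPOfSize bound (StarForest⇒EOP sf E))

  -- If G were complete, two edges of an EOP set would span a triangle in G[D].
  EOPOfSize⇒DiamAtLeast2 : 2 ≤ m → EOPOfSize m → DiamAtLeast2 G
  EOPOfSize⇒DiamAtLeast2 2≤m (D , eop , refl)
    with Finₚ.any? (λ u → Finₚ.any? λ v → ¬? (u Finₚ.≟ v) ×-dec ¬? (adj? u v))
  ... | yes (u , v , u≢v , ¬uv) = u , v , λ uv → [ u≢v , ¬uv ]′ (DistLe-1 uv)
  EOPOfSize⇒DiamAtLeast2 (s≤s (s≤s z≤n)) (e ∷ f ∷ _ , eop@((e≢f ∷ _) ∷ _) , refl) | no ¬far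
    with w , w∈f , w∉e ← DistinctE⇒Endpoint∉ e f (proj₁ e≢f) = ⊥-elim (
    StarForest⇒¬triangle (IsEOP⇒StarForest eop) (e , here refl , inj₁ refl) (e , here refl , inj₂ refl)
      (f , there (here refl) , w∈f) (isAdj e) (complete λ hi≡w → w∉e (inj₂ (sym hi≡w)))
      (complete λ lo≡w → w∉e (inj₁ (sym lo≡w))))
    where
    complete : ∀ {x y} → x ≢ y → Adj G x y
    complete {x} {y} x≢y with adj? x y
    ... | yes xy = xy
    ... | no ¬xy = ⊥-elim (¬far (x , y , x≢y , ¬xy))

  EOPNumber≤⇒AllF : Connected G → DiamAtLeast2 G → 1 ≤ k → EOPNumber≤ k → AllF G k
  EOPNumber≤⇒AllF conn diam≥2 1≤k bound =
    (diam≥2 , EOPNumber≤⇒DiamAtMost conn bound) , EOPNumber≤⇒C₂ bound , EOPNumber≤⇒C₃ conn bound 1≤k ,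
    λ _ → EOPNumber≤⇒C₄ bound

  -- Decomposing an EOP set into its star components

  module _ {D : List (Edge G)} (eop : IsEOP G D) (u : Fin n) where

    private
      sf : StarForest (VG G D)
      sf = IsEOP⇒StarForest eop

      -- decides which endpoint of a single-edge component is its centre: u first, then the smaller one
      Before : Fin n → Fin n → Set
      Before x y = x ≡ u ⊎ (y ≢ u × x <ᶠ y)

      Before? : ∀ x y → Dec (Before x y)
      Before? x y = (x Finₚ.≟ u) ⊎-dec (¬? (y Finₚ.≟ u) ×-dec (x Finₚ.<? y))

      Before-total : x ≢ y → Before x y ⊎ Before y x
      Before-total {x} {y} x≢y with x Finₚ.≟ u | y Finₚ.≟ u
      ... | yes x≡u | _       = inj₁ (inj₁ x≡u)
      ... | no _    | yes y≡u = inj₂ (inj₁ y≡u)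
      ... | no x≢u  | no y≢u with Finₚ.<-cmp x y
      ...   | tri< x<y _ _ = inj₁ (inj₂ (y≢u , x<y))
      ...   | tri≈ _ x≡y _ = ⊥-elim (x≢y x≡y)
      ...   | tri> _ _ y<x = inj₂ (inj₂ (x≢u , y<x))

      Before-asym : x ≢ y → Before x y → ¬ Before y x
      Before-asym x≢y (inj₁ refl)       (inj₁ refl)       = x≢y refl
      Before-asym _   (inj₁ refl)       (inj₂ (x≢u , _))  = x≢u refl
      Before-asym _   (inj₂ (y≢u , _))  (inj₁ refl)       = y≢u refl
      Before-asym _   (inj₂ (_ , x<y))  (inj₂ (_ , y<x))  = Finₚ.<-asym x<y y<x

      Centre : Fin n → Set
      Centre c = VG G D c × ∃ λ y → VG G D y × Adj G c y × Pendant (VG G D) y c × (Pendant (VG G D) c y → Before c y)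

      Centre? : ∀ c → Dec (Centre c)
      Centre? c = VG? D c ×-dec Finₚ.any? λ y →
        VG? D y ×-dec adj? c y ×-dec Pendant? (VG? D) y c ×-dec (Pendant? (VG? D) c y →-dec Before? c y)

      centre-leaf : Centre c → VG G D x → Adj G c x → Pendant (VG G D) x c
      centre-leaf {x = x} (c∈ , y , y∈ , cy , y↦c , _) x∈ cx with x Finₚ.≟ y
      ... | yes refl = y↦c
      ... | no x≢y with sf c∈ x∈ cx
      ...   | inj₁ c↦x = ⊥-elim (x≢y (sym (c↦x y y∈ cy)))
      ...   | inj₂ x↦c = x↦c

      centre-leaf-¬Centre : Centre c → VG G D x → Adj G c x → ¬ Centre x
      centre-leaf-¬Centre Cc@(_ , y , y∈ , cy , y↦c , c-tie) x∈ cx (_ , y′ , y′∈ , xy′ , y′↦x , x-tie)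
        with refl ← centre-leaf Cc x∈ cx y′ y′∈ xy′
        with refl ← y′↦x y y∈ cy =
        Before-asym (Adj⇒≢ cx) (c-tie y′↦x) (x-tie y↦c)

      centre-of-single-edge : VG G D x → VG G D y → Adj G x y → Pendant (VG G D) x y → Pendant (VG G D) y x →
            Centre x ⊎ ∃ λ c → Centre c × Adj G c x
      centre-of-single-edge x∈ y∈ xy x↦y y↦x with Before-total (Adj⇒≢ xy)
      ... | inj₁ x-first = inj₁ (x∈ , _ , y∈ , xy , y↦x , λ _ → x-first)
      ... | inj₂ y-first = inj₂ (_ , (y∈ , _ , x∈ , Adj-sym xy , x↦y , λ _ → y-first) , Adj-sym xy)

      Centre-or-leaf : VG G D x → Centre x ⊎ ∃ λ c → Centre c × Adj G c x
      Centre-or-leaf {x} x∈ with y , y∈ , xy ← VG-neighbour x∈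
        with sf x∈ y∈ xy | Pendant? (VG? D) x y | Pendant? (VG? D) y x
      ...   | _        | yes x↦y | yes y↦x = centre-of-single-edge x∈ y∈ xy x↦y y↦x
      ...   | inj₁ x↦y | _       | no ¬y↦x =
        inj₂ (y , (y∈ , x , x∈ , Adj-sym xy , x↦y , λ y↦x → ⊥-elim (¬y↦x y↦x)) , Adj-sym xy)
      ...   | inj₂ y↦x | no ¬x↦y | _       = inj₁ (x∈ , y , y∈ , xy , y↦x , λ x↦y → ⊥-elim (¬x↦y x↦y))
      ...   | inj₁ x↦y | no ¬x↦y | _       = ⊥-elim (¬x↦y x↦y)
      ...   | inj₂ y↦x | _       | no ¬y↦x = ⊥-elim (¬y↦x y↦x)

      deg : Fin n → ℕ
      deg c = length (NbrIn D c)

      byDegree : DecTotalOrder _ _ _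
      byDegree = On.decTotalOrder ℕₚ.≤-decTotalOrder deg

      open Sort byDegree using (sort; sort-↭; sort-↗)

      centres : List (Fin n)
      centres = sort (filter Centre? (allFin n))

      centres⁺ : Centre c → c ∈ centres
      centres⁺ {c} Cc = ∈-resp-↭ (↭-sym (sort-↭ _)) (∈-filter⁺ Centre? (∈-allFin c) Cc)

      centres⁻ : c ∈ centres → Centre c
      centres⁻ c∈ = proj₂ (∈-filter⁻ Centre? {xs = allFin n} (∈-resp-↭ (sort-↭ _) c∈))

      centres-Unique : Unique centres
      centres-Unique = Permutationₛ.Unique-resp-↭ (setoid (Fin n)) (↭⇒↭ₛ (↭-sym (sort-↭ _)))
                         (Uniqueₚ.filter⁺ Centre? (Uniqueₚ.allFin⁺ n))

      s : ℕ
      s = length centres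

      centre : Fin s → Fin n
      centre = lookup centres

      r : Fin s → ℕ
      r i = deg (centre i)

      centre-Centre : ∀ i → Centre (centre i)
      centre-Centre i = centres⁻ (∈-lookup i)

      centre-injective : ∀ {i j} → i ≢ j → centre i ≢ centre j
      centre-injective i≢j eq = i≢j (lookup-injective centres-Unique eq)

      index-of : Centre c → ∃ λ i → centre i ≡ c
      index-of Cc = _ , sym (Anyₚ.lookup-index (centres⁺ Cc))

      leafOf : Edge G → Fin n
      leafOf e with Centre? (lo e)
      ... | yes _ = hi e
      ... | no _  = lo e

      leafOf-spec : e ∈ D → ∃ λ c → Centre c × SameEnds G e (leafOf e) c
      leafOf-spec {e} e∈ with Centre? (lo e)
      ... | yes Clo = lo e , Clo , inj₂ (refl , refl)
      ... | no ¬Clo with Centre-or-leaf (e , e∈ , inj₁ refl)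
      ...   | inj₁ Clo = ⊥-elim (¬Clo Clo)
      ...   | inj₂ (c , Cc , c-lo) =
        c , Cc , inj₁ (refl , sym (centre-leaf Cc (e , e∈ , inj₁ refl) c-lo (hi e) (e , e∈ , inj₂ refl) (isAdj e)))

      leafOf-unique : e ∈ D → Centre c → SameEnds G e c x → leafOf e ≡ x
      leafOf-unique {e} e∈ Cc ecx with Centre? (lo e) | ecx
      ... | yes _   | inj₁ (refl , refl) = refl
      ... | no ¬Clo | inj₁ (refl , refl) = ⊥-elim (¬Clo Cc)
      ... | yes Clo | inj₂ (refl , refl) = ⊥-elim (centre-leaf-¬Centre Cc (e , e∈ , inj₁ refl) (Adj-sym (isAdj e)) Clo)
      ... | no _    | inj₂ (refl , refl) = refl

      leafOf-distinct : e ∈ D → f ∈ D → DistinctE G e f → leafOf e ≢ leafOf f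
      leafOf-distinct {e} {f} e∈ f∈ e≢f eq
        with c , Cc , eℓc ← leafOf-spec e∈ | c′ , Cc′ , fℓc′ ← leafOf-spec f∈
        with refl ← centre-leaf Cc (e , e∈ , proj₁ (SameEnds⇒Endpoints e eℓc)) (Adj-sym (SameEnds⇒Adj e eℓc))
                      c′ (f , f∈ , proj₂ (SameEnds⇒Endpoints f fℓc′)) (subst (λ v → Adj G v c′) (sym eq) (SameEnds⇒Adj f fℓc′))
        = SameEnds⇒¬DistinctE e f eℓc (subst (λ v → SameEnds G f v c′) (sym eq) fℓc′) e≢f

      leaves-disjoint : Centre c → Centre c′ → x ∈ NbrIn D c → x ∈ NbrIn D c′ → c ≡ c′
      leaves-disjoint Cc Cc′ x∈ x∈′ =
        let x∈V , cx = NbrIn⁻ x∈ ; _ , c′x = NbrIn⁻ x∈′ in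
        sym (centre-leaf Cc x∈V cx _ (proj₁ Cc′) (Adj-sym c′x))

      allLeaves : List (Fin n)
      allLeaves = concatMap (NbrIn D) centres

      allLeaves-Unique : Unique allLeaves
      allLeaves-Unique = Uniqueₚ.concat⁺ (Allₚ.map⁺ (All.tabulate λ _ → NbrIn-Unique))
        (AllPairsₚ.map⁺ (AllPairs-mapWith∈ centres
          (λ c∈ c′∈ c≢c′ (x∈ , x∈′) → c≢c′ (leaves-disjoint (centres⁻ c∈) (centres⁻ c′∈) x∈ x∈′)) centres-Unique))

      size≡ : length D ≡ length allLeaves
      size≡ = ℕₚ.≤-antisym
        (subst (_≤ length allLeaves) (Listₚ.length-map leafOf D)
          (Unique-⊆⇒length≤ (AllPairsₚ.map⁺ (AllPairs-mapWith∈ D (λ e∈ f∈ → leafOf-distinct e∈ f∈ ∘ proj₁) eop))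
                             leaves⊆))
        (subst (length allLeaves ≤_) (Listₚ.length-map leafOf D) (Unique-⊆⇒length≤ allLeaves-Unique ⊆leaves))
        where
        leaves⊆ : x ∈ map leafOf D → x ∈ allLeaves
        leaves⊆ x∈ with e , e∈ , refl ← ∈-map⁻ leafOf x∈ with c , Cc , eℓc ← leafOf-spec e∈ =
          ∈-concatMap⁺ (NbrIn D) (lose (centres⁺ Cc)
            (NbrIn⁺ (e , e∈ , proj₁ (SameEnds⇒Endpoints e eℓc)) (Adj-sym (SameEnds⇒Adj e eℓc))))
        ⊆leaves : x ∈ allLeaves → x ∈ map leafOf D
        ⊆leaves x∈ with c , c∈ , x∈c ← find (∈-concatMap⁻ (NbrIn D) x∈)
          with g , g∈ , gcx ← IsEOP⇒induced eop (proj₁ (centres⁻ c∈)) (proj₁ (NbrIn⁻ x∈c)) (proj₂ (NbrIn⁻ x∈c)) =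
          subst (_∈ map leafOf D) (leafOf-unique g∈ (centres⁻ c∈) gcx) (∈-map⁺ leafOf g∈)

      components : StarComponents G D s r
      components = record
        { centre       = centre
        ; leaves       = λ i → NbrIn D (centre i)
        ; leavesUnique = λ i → NbrIn-Unique
        ; leavesCount  = λ i → refl
        ; centreAdj    = λ i → All.tabulate (proj₂ ∘ NbrIn⁻)
        ; leavesIndep  = λ i → AllPairs-tabulate∈ _ λ x∈ y∈ xy →
                           let x∈V , cx = NbrIn⁻ x∈ ; y∈V , cy = NbrIn⁻ y∈ in
                           Adj-irrefl (subst (Adj G (centre i)) (centre-leaf (centre-Centre i) x∈V cx _ y∈V xy) cy)
        ; cover        = cover
        ; within       = within
        ; disjoint     = disjoint
        ; separated    = separated
        }
        where
        InC = InComp G centre (λ i → NbrIn D (centre i))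
        cover : ∀ x → VG G D x → ∃ λ i → InC i x
        cover x x∈ with Centre-or-leaf x∈
        ... | inj₁ Cx = let i , ci≡x = index-of Cx in i , inj₁ (sym ci≡x)
        ... | inj₂ (c , Cc , cx) = let i , ci≡c = index-of Cc in
                                   i , inj₂ (NbrIn⁺ x∈ (subst (λ v → Adj G v x) (sym ci≡c) cx))
        within : ∀ i x → InC i x → VG G D x
        within i x (inj₁ refl) = proj₁ (centre-Centre i)
        within i x (inj₂ x∈)   = proj₁ (NbrIn⁻ x∈)
        disjoint : ∀ i j x → i ≢ j → InC i x → ¬ InC j x
        disjoint i j x i≢j (inj₁ refl) (inj₁ x≡cj) = centre-injective i≢j x≡cj
        disjoint i j x i≢j (inj₁ refl) (inj₂ x∈)   =
          centre-leaf-¬Centre (centre-Centre j) (proj₁ (NbrIn⁻ x∈)) (proj₂ (NbrIn⁻ x∈)) (centre-Centre i)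
        disjoint i j x i≢j (inj₂ x∈)   (inj₁ refl) =
          centre-leaf-¬Centre (centre-Centre i) (proj₁ (NbrIn⁻ x∈)) (proj₂ (NbrIn⁻ x∈)) (centre-Centre j)
        disjoint i j x i≢j (inj₂ x∈)   (inj₂ x∈′)  =
          centre-injective i≢j (leaves-disjoint (centre-Centre i) (centre-Centre j) x∈ x∈′)
        separated : ∀ i j x y → i ≢ j → InC i x → InC j y → ¬ Adj G x y
        separated i j x y i≢j (inj₁ refl) (inj₁ refl) xy =
          centre-leaf-¬Centre (centre-Centre i) (proj₁ (centre-Centre j)) xy (centre-Centre j)
        separated i j x y i≢j (inj₁ refl) (inj₂ y∈)   xy =
          centre-injective i≢j (centre-leaf (centre-Centre j) (proj₁ (NbrIn⁻ y∈)) (proj₂ (NbrIn⁻ y∈)) _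
                                             (proj₁ (centre-Centre i)) (Adj-sym xy))
        separated i j x y i≢j (inj₂ x∈)   (inj₁ refl) xy =
          centre-injective i≢j (sym (centre-leaf (centre-Centre i) (proj₁ (NbrIn⁻ x∈)) (proj₂ (NbrIn⁻ x∈)) _
                                                  (proj₁ (centre-Centre j)) xy))
        separated i j x y i≢j (inj₂ x∈)   (inj₂ y∈)   xy
          with refl ← centre-leaf (centre-Centre i) (proj₁ (NbrIn⁻ x∈)) (proj₂ (NbrIn⁻ x∈)) y (proj₁ (NbrIn⁻ y∈)) xy =
          centre-leaf-¬Centre (centre-Centre j) (proj₁ (NbrIn⁻ y∈)) (proj₂ (NbrIn⁻ y∈)) (centre-Centre i)

      partition : IsPartition G (length D) s r
      partition =
        (λ i → let _ , y , y∈ , cy , _ = centre-Centre i in 1≤length (NbrIn⁺ y∈ cy)) ,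
        (λ i j i≤j → Sortedₚ.lookup-mono-≤ (DecTotalOrder.totalOrder byDegree) (sort-↗ _) i≤j) ,
        (begin
          sum (map r (allFin s)) ≡⟨ cong sum (map-lookup-allFin deg centres) ⟩
          sum (map deg centres)  ≡⟨ sum-map-length (NbrIn D) centres ⟩
          length allLeaves       ≡⟨ size≡ ⟨
          length D               ∎)
        where open ≡-Reasoning

    -- abstract: unfolding the sorted list of centres makes checking the users of this lemma very costly
    abstract
      IsEOP⇒StarComponents : VG G D u → VG G D x → Adj G u x → Pendant (VG G D) x u →
                             ∃ λ s → ∃ λ r → Σ (StarComponents G D s r) λ SC →
                             IsPartition G (length D) s r × ∃ λ j → StarComponents.centre SC j ≡ u
      IsEOP⇒StarComponents u∈ x∈ ux x↦u =
        s , r , components , partition , index-of (u∈ , _ , x∈ , ux , x↦u , λ _ → inj₁ refl)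

  -- No EOP set of size k + 1 under C₂, C₃ and C₄

  IsInducedMatching⇒C₃-fails : C₃ G k → IsInducedMatching G D → length D ≢ suc k
  IsInducedMatching⇒C₃-fails {D = e ∷ M} c₃ im@(e-apart ∷ im′) refl =
    let x , y , x≢y , x∈ , y∈ , lo-x , lo-y = c₃ M im′ refl (lo e) lo∉ in
    x≢y (trans (lo↦hi x (VG-mono there x∈) lo-x) (sym (lo↦hi y (VG-mono there y∈) lo-y)))
    where
    lo∉ : ¬ VG G M (lo e)
    lo∉ (g , g∈ , lo∈g) = proj₁ (All.lookup e-apart g∈ _ _ (inj₁ refl) lo∈g) refl
    lo↦hi : Pendant (VG G (e ∷ M)) (lo e) (hi e)
    lo↦hi = IsInducedMatching⇒Pendant im (e , here refl , inj₁ refl) (e , here refl , inj₂ refl) (isAdj e)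

  through-length≤ : AllPairs (DistinctE G) D → (∀ {e} → e ∈ D → Endpoint G e u) → length D ≤ length (NbrIn D u)
  through-length≤ {D} {u} distinct through =
    subst (_≤ length (NbrIn D u)) (Listₚ.length-map far D) (Unique-⊆⇒length≤ unique far⊆)
    where
    far : Edge G → Fin n
    far e with lo e Finₚ.≟ u
    ... | yes _ = hi e
    ... | no _  = lo e
    far-spec : e ∈ D → SameEnds G e u (far e)
    far-spec {e} e∈ with lo e Finₚ.≟ u | through e∈
    ... | yes refl | _         = inj₁ (refl , refl)
    ... | no lo≢u  | inj₁ u≡lo = ⊥-elim (lo≢u (sym u≡lo))
    ... | no _     | inj₂ u≡hi = inj₂ (u≡hi , refl)
    unique : Unique (map far D)
    unique = AllPairsₚ.map⁺ (AllPairs-mapWith∈ D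
      (λ {e} {f} e∈ f∈ e≢f eq → SameEnds⇒¬DistinctE e f (far-spec e∈) (subst (SameEnds G f u) (sym eq) (far-spec f∈)) e≢f)
      distinct)
    far⊆ : x ∈ map far D → x ∈ NbrIn D u
    far⊆ x∈ with e , e∈ , refl ← ∈-map⁻ far x∈ =
      NbrIn⁺ (e , e∈ , proj₂ (SameEnds⇒Endpoints e (far-spec e∈))) (SameEnds⇒Adj e (far-spec e∈))

  -- G[D] is then an induced star with at least |D| leaves.
  spanning-star⇒C₂-fails : C₂ G k → IsEOP G D → length D ≡ suc k → ¬ (∃ λ w → VG G D w × w ≢ u × ¬ Adj G u w) →
                           (∀ v → VG G D v → Adj G u v → Pendant (VG G D) v u) → ⊥
  spanning-star⇒C₂-fails {k} {D} {u} c₂ eop len ¬far leaf =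
    c₂ (length (NbrIn D u))
       (subst (_≤ length (NbrIn D u)) (trans len (ℕₚ.+-comm 1 k)) (through-length≤ (AllPairs.map proj₁ eop) through))
       (u , NbrIn D u , NbrIn-Unique , refl , All.tabulate (proj₂ ∘ NbrIn⁻) ,
        AllPairs-tabulate∈ _ λ v∈ v′∈ vv′ →
          let v∈V , uv = NbrIn⁻ v∈ ; v′∈V , uv′ = NbrIn⁻ v′∈ in
          Adj-irrefl (subst (Adj G u) (leaf _ v∈V uv _ v′∈V vv′) uv′))
    where
    through : e ∈ D → Endpoint G e u
    through {e} e∈ with Endpoint? e u | adj? u (lo e)
    ... | yes u∈e | _       = u∈e
    ... | no u∉e  | yes ulo =
      ⊥-elim (u∉e (inj₂ (sym (leaf (lo e) (e , e∈ , inj₁ refl) ulo (hi e) (e , e∈ , inj₂ refl) (isAdj e)))))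
    ... | no u∉e  | no ¬ulo = ⊥-elim (¬far (lo e , (e , e∈ , inj₁ refl) , (λ lo≡u → u∉e (inj₁ (sym lo≡u))) , ¬ulo))

  -- C₃ (if G[D] is an induced matching) or C₄ (u and w lie in different star components)
  -- would give y a second neighbour in V(G[D]).
  pendant-outside⇒C₃C₄-fails : C₃ G k → (3 ≤ k → C₄ G k) → IsEOP G D → length D ≡ k →
    ¬ VG G D y → Adj G y u → (∀ v → VG G D v → Adj G y v → v ≡ u) →
    VG G D u → VG G D x → Adj G u x → Pendant (VG G D) x u → VG G D w → w ≢ u → ¬ Adj G u w → ⊥
  pendant-outside⇒C₃C₄-fails {D = D} c₃ c₄ eop refl y∉ yu y-only u∈ x∈ ux x↦u w∈ w≢u ¬uw with HasDegree2? D
  ... | no ¬deg2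
    with a , b , a≢b , a∈ , b∈ , ya , yb ← c₃ D (¬HasDegree2⇒IsInducedMatching eop ¬deg2) refl _ y∉ =
    a≢b (trans (y-only a a∈ ya) (sym (y-only b b∈ yb)))
  ... | yes deg2
    with s , r , SC , part , j , refl ← IsEOP⇒StarComponents eop _ u∈ x∈ ux x↦u
    with i , 2≤ri ← HasDegree2⇒large-component SC deg2
    with iw , w∈iw ← StarComponents.cover SC _ w∈
    with 2≤s ← 2≤-distinct (InComp-other SC w∈iw w≢u ¬uw)
    with s<k ← IsPartition⇒suc≤ part i 2≤ri
    with y′ , y′∈ , y′≢u , yy′ ← c₄ (ℕₚ.≤-trans (s≤s 2≤s) s<k) s 2≤s (ℕₚ.∸-monoˡ-≤ 1 s<k) r part D eop refl SC j _ y∉ yu =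
    y′≢u (y-only y′ y′∈ yy′)

  -- Dropping the leaf edge uy leaves y outside V(G[D]) with u as its only neighbour there.
  remove-leaf-edge⇒C₃C₄-fails : C₃ G k → (3 ≤ k → C₄ G k) → IsEOP G (f ∷ D) → length D ≡ k → SameEnds G f u y →
    VG G (f ∷ D) x → Adj G u x → x ≢ y → VG G (f ∷ D) w → w ≢ u → ¬ Adj G u w → ⊥
  remove-leaf-edge⇒C₃C₄-fails {f = f} {D} {u} {y} {x} {w} c₃ c₄ eop@(f-apart ∷ eop′) len fuy x∈ ux x≢y w∈ w≢u ¬uw
    with IsEOP⇒induced eop (f , here refl , proj₁ (SameEnds⇒Endpoints f fuy)) x∈ ux
  ... | h , here refl , hux with SameEnds-unique f hux fuy
  ...   | inj₁ (_ , x≡y) = x≢y x≡y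
  ...   | inj₂ (_ , x≡u) = Adj⇒≢ ux (sym x≡u)
  remove-leaf-edge⇒C₃C₄-fails {f = f} {D} {u} {y} {x} {w} c₃ c₄ eop@(f-apart ∷ eop′) len fuy x∈ ux x≢y w∈ w≢u ¬uw
    | h , there h∈ , hux =
    pendant-outside⇒C₃C₄-fails c₃ c₄ eop′ len y∉ (Adj-sym uy) y-only
      (h , h∈ , proj₁ (SameEnds⇒Endpoints h hux)) (h , h∈ , proj₂ (SameEnds⇒Endpoints h hux)) ux
      (λ v v∈ → leaf x x∈ ux v (VG-mono there v∈)) (outside-f w∈) w≢u ¬uw
    where
    uy = SameEnds⇒Adj f fuy
    u∈ : VG G (f ∷ D) u
    u∈ = f , here refl , proj₁ (SameEnds⇒Endpoints f fuy)
    y∈ : VG G (f ∷ D) y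
    y∈ = f , here refl , proj₂ (SameEnds⇒Endpoints f fuy)
    leaf : ∀ v → VG G (f ∷ D) v → Adj G u v → Pendant (VG G (f ∷ D)) v u
    leaf = HasDegree2⇒Pendant eop u∈ x∈ y∈ ux uy x≢y
    y-only : ∀ v → VG G D v → Adj G y v → v ≡ u
    y-only v v∈ yv = leaf y y∈ uy v (VG-mono there v∈) yv
    y∉ : ¬ VG G D y
    y∉ (g , g∈ , y∈g) =
      SameEnds⇒¬DistinctE f g fuy
        (SameEnds-sym g (Pendant⇒SameEnds g (λ v v∈g → g , there g∈ , v∈g) y∈g (leaf y y∈ uy)))
        (proj₁ (All.lookup f-apart g∈))
    outside-f : VG G (f ∷ D) w → VG G D w
    outside-f (g , there g∈ , w∈g) = g , g∈ , w∈g
    outside-f (g , here refl , w∈f) = [ (λ w≡u → ⊥-elim (w≢u w≡u)) , (λ { refl → ⊥-elim (¬uw uy) }) ]′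
                                        (SameEnds-Endpoint f fuy w∈f)

  C₂∧C₃∧C₄⇒¬EOPOfSize : C₂ G k → C₃ G k → (3 ≤ k → C₄ G k) → ¬ EOPOfSize (suc k)
  C₂∧C₃∧C₄⇒¬EOPOfSize c₂ c₃ c₄ (D , eop , len) with HasDegree2? D
  ... | no ¬deg2 = IsInducedMatching⇒C₃-fails c₃ (¬HasDegree2⇒IsInducedMatching eop ¬deg2) len
  ... | yes (u , x , y , u∈ , x∈ , y∈ , ux , uy , x≢y)
    with Finₚ.any? (λ w → VG? D w ×-dec ¬? (w Finₚ.≟ u) ×-dec ¬? (adj? u w))
  ...   | no ¬far = spanning-star⇒C₂-fails c₂ eop len ¬far (HasDegree2⇒Pendant eop u∈ x∈ y∈ ux uy x≢y)
  ...   | yes (w , w∈ , w≢u , ¬uw)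
    with f , f∈ , fuy ← IsEOP⇒induced eop u∈ y∈ uy
    with D′ , D↭ ← ∈⇒↭∷ f∈ =
    remove-leaf-edge⇒C₃C₄-fails c₃ c₄ (IsEOP-resp-↭ D↭ eop) (ℕₚ.suc-injective (trans (sym (↭-length D↭)) len)) fuy
      (VG-mono (∈-resp-↭ D↭) x∈) ux x≢y (VG-mono (∈-resp-↭ D↭) w∈) w≢u ¬uw

  -- Deciding whether an EOP set of a given size exists

  DistinctE? : ∀ e f → Dec (DistinctE G e f)
  DistinctE? e f = ¬? ((lo e Finₚ.≟ lo f) ×-dec (hi e Finₚ.≟ hi f))

  HasCommonEdge? : ∀ e f → Dec (HasCommonEdge G e f)
  HasCommonEdge? e f = Finₚ.any? λ x → Finₚ.any? λ y →
    Endpoint? e x ×-dec Endpoint? f y ×-dec adj? x y ×-dec ¬? (SameEnds? e x y) ×-dec ¬? (SameEnds? f x y)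

  IsEOP? : ∀ D → Dec (IsEOP G D)
  IsEOP? = AllPairs.allPairs? λ e f → DistinctE? e f ×-dec ¬? (HasCommonEdge? e f)

  edgesBetween : Fin n → Fin n → List (Edge G)
  edgesBetween x y with x Finₚ.<? y | adj? x y
  ... | yes x<y | yes xy = edge x y x<y xy ∷ []
  ... | _       | _      = []

  allEdges : List (Edge G)
  allEdges = concatMap (λ x → concatMap (edgesBetween x) (allFin n)) (allFin n)

  ∈-allEdges : ∀ e → e ∈ allEdges
  ∈-allEdges e@(edge x y x<y xy) =
    ∈-concatMap⁺ _ (lose (∈-allFin x) (∈-concatMap⁺ _ (lose (∈-allFin y) ∈-edgesBetween)))
    where
    ∈-edgesBetween : e ∈ edgesBetween x y
    ∈-edgesBetween with x Finₚ.<? y | adj? x y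
    ... | yes x<y′ | yes xy′ rewrite Finₚ.<-irrelevant x<y′ x<y | Decidable⇒UIP.≡-irrelevant Bool._≟_ xy′ xy = here refl
    ... | no ¬x<y  | _       = ⊥-elim (¬x<y x<y)
    ... | yes _    | no ¬xy  = ⊥-elim (¬xy xy)

  edgeLists : ℕ → List (List (Edge G))
  edgeLists zero    = [] ∷ []
  edgeLists (suc m) = concatMap (λ e → map (e ∷_) (edgeLists m)) allEdges

  ∈-edgeLists : ∀ D → D ∈ edgeLists (length D)
  ∈-edgeLists []      = here refl
  ∈-edgeLists (e ∷ D) = ∈-concatMap⁺ _ (lose (∈-allEdges e) (∈-map⁺ (e ∷_) (∈-edgeLists D)))

  edgeLists-length : ∀ m → D ∈ edgeLists m → length D ≡ m
  edgeLists-length zero    (here refl) = refl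
  edgeLists-length (suc m) D∈
    with e , _ , D∈e ← find (∈-concatMap⁻ _ {xs = allEdges} D∈)
    with D′ , D′∈ , refl ← ∈-map⁻ (e ∷_) D∈e = cong suc (edgeLists-length m D′∈)

  EOPOfSize? : ∀ m → Dec (EOPOfSize m)
  EOPOfSize? m = map′ (λ (D , D∈ , eop) → D , eop , edgeLists-length m D∈)
                      (λ { (D , eop , refl) → D , ∈-edgeLists D , eop })
                      (map′ find (λ (D , D∈ , eop) → lose D∈ eop) (Any.any? IsEOP? (edgeLists m)))

  EOPOfSize-≤ : k ≤ m → EOPOfSize m → EOPOfSize k
  EOPOfSize-≤ {k} k≤m (D , eop , refl) =
    take k D , AllPairsₚ.take⁺ k eop , trans (Listₚ.length-take k D) (ℕₚ.m≤n⇒m⊓n≡m k≤m)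

  ¬EOPOfSize⇒EOPNumber≤ : ¬ EOPOfSize (suc k) → EOPNumber≤ k
  ¬EOPOfSize⇒EOPNumber≤ {k} ¬eop D eop with length D ℕₚ.≤? k
  ... | yes |D|≤k = |D|≤k
  ... | no  |D|≰k = ⊥-elim (¬eop (EOPOfSize-≤ (ℕₚ.≰⇒> |D|≰k) (D , eop , refl)))

corollary2p4 : ∀ {n} (G : Graph n) (t : ℕ) → Connected G → 3 ≤ t →
    (∀ s → 1 ≤ s → s ≤ t ∸ 1 → ¬ IsStar G s) →
    EOPNumberIs G t ⇔ (AllF G t × ¬ AllF G (t ∸ 1))
corollary2p4 G t@(suc t-1@(suc (suc _))) conn (s≤s (s≤s (s≤s z≤n))) _ = mk⇔ to from
  where
  to : EOPNumberIs G t → AllF G t × ¬ AllF G t-1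
  to (eop , bound) = EOPNumber≤⇒AllF conn (EOPOfSize⇒DiamAtLeast2 (s≤s (s≤s z≤n)) eop) (s≤s z≤n) bound ,
                     λ (_ , c₂ , c₃ , c₄) → C₂∧C₃∧C₄⇒¬EOPOfSize c₂ c₃ c₄ eop
  from : AllF G t × ¬ AllF G t-1 → EOPNumberIs G t
  from (((diam≥2 , _) , c₂ , c₃ , c₄) , ¬F) with EOPOfSize? t
  ... | yes eop = eop , ¬EOPOfSize⇒EOPNumber≤ (C₂∧C₃∧C₄⇒¬EOPOfSize c₂ c₃ c₄)
  ... | no ¬eop = ⊥-elim (¬F (EOPNumber≤⇒AllF conn diam≥2 (s≤s z≤n) (¬EOPOfSize⇒EOPNumber≤ ¬eop)))
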